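{- Let $\mathcal{C}\subseteq\mathbb{F}_Q^n$, $Q=q^m$, be a Gabidulin rank-metric code of dimension $k$, with $q$-matroid $\mathcal{M}_\mathcal{C}$ and associated classical matroid $Cl(\mathcal{M}_\mathcal{C})$ on $P(\mathbb{F}_q^n)$. Let $r\ge1$, $\tilde{Q}=Q^r$, and let $A^{\tilde{Q}}_{\mathcal{C},n}$ be the number of codewords of $\tilde{\mathcal{C}}=\mathcal{C}\otimes_{\mathbb{F}_Q}\mathbb{F}_{\tilde{Q}}$ of rank weight $n$. Then $$A^{\tilde{Q}}_{\mathcal{C},n}=(-1)^{\frac{q^n-1}{q-1}}\sum_{\gamma\subseteq P(\mathcal{E})}(-1)^{|\gamma|}\tilde{Q}^{\mathbf{n}^*_{Cl(\mathcal{M}_\mathcal{C})}(\gamma)},$$ where $\mathbf{n}^*_{Cl(\mathcal{M}_\mathcal{C})}$ is the nullity function of the dual matroid $Cl(\mathcal{M}_\mathcal{C})^*$.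
   Context: $\mathcal{E}=\mathbb{F}_q^n$. A Gabidulin code is an $\mathbb{F}_Q$-linear subspace $\mathcal{C}\subseteq\mathbb{F}_Q^n$ of dimension $k$. With a fixed $\mathbb{F}_q$-basis of $\mathbb{F}_Q$, $c$ is represented by the $m\times n$ matrix over $\mathbb{F}_q$ whose $j$-th column is the coordinates of $c_j$; $Rsupp(c)$ is its row space; the rank weight is $\dim Rsupp(c)$. $\tilde{\mathcal{C}}$ is the $\mathbb{F}_{\tilde{Q}}$-span of $\mathcal{C}$ in $\mathbb{F}_{\tilde{Q}}^n$, with rank supports/weights defined the same way using an $\mathbb{F}_q$-basis of $\mathbb{F}_{\tilde{Q}}$. $\mathcal{C}(X)=\{c\in\mathcal{C}:Rsupp(c)\subseteq X\}$ and $\mathcal{M}_\mathcal{C}=(\mathcal{E},\rho_\mathcal{C})$ with $\rho_\mathcal{C}(X)=k-\dim_{\mathbb{F}_Q}\mathcal{C}(X^\perp)$ ($X^\perp$ for the standard dot product). $P(\mathcal{E})$ is the set of $1$-dimensional subspaces; $Cl(\mathcal{M}_\mathcal{C})$ is the matroid on $P(\mathcal{E})$ with rank $\mathbf{r}(S)=\rho_\mathcal{C}(\langle S\rangle)$. For a matroid $(E,\mathbf{r})$, the dual has rank $\mathbf{r}^*(Y)=|Y|+\mathbf{r}(E\setminus Y)-\mathbf{r}(E)$ and nullity $|Y|-\mathbf{r}^*(Y)$. -}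

module Defs where

open import Level using (0ℓ)
open import Data.Bool using (Bool; true; false; not; _∧_; _∨_; if_then_else_)
open import Data.Nat using (ℕ; zero; suc; _∸_; _⊔_) renaming (_+_ to _+ℕ_; _≟_ to _≟ℕ_)
open import Data.Integer using (ℤ; +_; -1ℤ) renaming (_*_ to _*ℤ_; _+_ to _+ℤ_; _^_ to _^ℤ_)
open import Data.List using (List; []; _∷_; [_]; length; concatMap; filterᵇ; upTo)
  renaming (map to mapL; foldr to foldrL)
open import Data.Vec using (Vec; []; _∷_; replicate; zipWith; transpose; concat; fromList; toList)
  renaming (map to mapV; foldr′ to foldrV)
open import Data.Vec.Properties using (≡-dec)
open import Data.Bool.ListAction using (any; all)
open import Data.Maybe using (Maybe; just; nothing)
open import Data.Product using (∃)
open import Data.List.Membership.Propositional using (_∈_)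
open import Data.List.Relation.Unary.Unique.Propositional using (Unique)
open import Relation.Binary.PropositionalEquality using (_≡_; _≢_)
open import Relation.Binary.Definitions using (DecidableEquality)
open import Relation.Nullary.Decidable using (⌊_⌋)
open import Algebra.Core using (Op₁; Op₂)
open import Algebra.Structures using (IsCommutativeRing)

vecsOver : {A : Set} → List A → (n : ℕ) → List (Vec A n)
vecsOver xs zero    = [ [] ]
vecsOver xs (suc n) = concatMap (λ x → mapL (x ∷_) (vecsOver xs n)) xs

-- the entries of a vector selected by a Boolean mask (a subset of indices)
select : {A : Set} {N : ℕ} → Vec Bool N → Vec A N → List A
select []          []       = []
select (true ∷ γ)  (x ∷ xs) = x ∷ select γ xs
select (false ∷ γ) (x ∷ xs) = select γ xs

card : {N : ℕ} → Vec Bool N → ℕ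
card γ = length (select γ γ)

subsets : (N : ℕ) → List (Vec Bool N)
subsets N = vecsOver (true ∷ false ∷ []) N

sumℤ : List ℤ → ℤ
sumℤ = foldrL _+ℤ_ (+ 0)

record FiniteField : Set₁ where
  field
    Carrier           : Set
    _≟_               : DecidableEquality Carrier
    _+_ _*_           : Op₂ Carrier
    -_                : Op₁ Carrier
    0# 1#             : Carrier
    isCommutativeRing : IsCommutativeRing _≡_ _+_ _*_ -_ 0# 1#
    0≢1               : 0# ≢ 1#
    inverse           : ∀ x → x ≢ 0# → ∃ λ y → x * y ≡ 1#
    elements          : List Carrier
    elements-complete : ∀ x → x ∈ elements
    elements-unique   : Unique elements

  size : ℕ
  size = length elements

-- Linear algebra over a finite field F, vectors in F^n are Vec Carrier n.
-- Subsets / subspaces of F^n are represented by Boolean predicates.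

module LA (F : FiniteField) where
  open FiniteField F

  zeroV : {n : ℕ} → Vec Carrier n
  zeroV = replicate _ 0#

  _≟V_ : {n : ℕ} → DecidableEquality (Vec Carrier n)
  _≟V_ = ≡-dec _≟_

  isZero : Carrier → Bool
  isZero x = ⌊ x ≟ 0# ⌋

  isZeroV : {n : ℕ} → Vec Carrier n → Bool
  isZeroV v = ⌊ v ≟V zeroV ⌋

  lincomb : {n d : ℕ} → Vec Carrier d → Vec (Vec Carrier n) d → Vec Carrier n
  lincomb []       []       = zeroV
  lincomb (a ∷ as) (v ∷ vs) = zipWith _+_ (mapV (a *_) v) (lincomb as vs)

  dot : {n : ℕ} → Vec Carrier n → Vec Carrier n → Carrier
  dot u v = foldrV _+_ 0# (zipWith _*_ u v)

  LinIndep : {n d : ℕ} → Vec (Vec Carrier n) d → Set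
  LinIndep vs = ∀ a → lincomb a vs ≡ zeroV → a ≡ zeroV

  allVecs : (n : ℕ) → List (Vec Carrier n)
  allVecs n = vecsOver elements n

  isIndep : {n d : ℕ} → Vec (Vec Carrier n) d → Bool
  isIndep {d = d} vs = all (λ a → not (isZeroV (lincomb a vs)) ∨ isZeroV a) (allVecs d)

  inSpan : {n d : ℕ} → Vec (Vec Carrier n) d → Vec Carrier n → Bool
  inSpan {d = d} vs w = any (λ a → ⌊ lincomb a vs ≟V w ⌋) (allVecs d)

  hasIndepFamily : {n : ℕ} → (Vec Carrier n → Bool) → ℕ → Bool
  hasIndepFamily {n} X d =
    any (λ vs → isIndep vs ∧ all X (toList vs)) (vecsOver (allVecs n) d)

  dim : {n : ℕ} → (Vec Carrier n → Bool) → ℕ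
  dim {n} X = foldrL _⊔_ 0 (filterᵇ (hasIndepFamily X) (upTo (suc n)))

  _⊆ᵇ_ : {n : ℕ} → (Vec Carrier n → Bool) → (Vec Carrier n → Bool) → Bool
  _⊆ᵇ_ {n} X Y = all (λ w → not (X w) ∨ Y w) (allVecs n)

  perp : {n : ℕ} → (Vec Carrier n → Bool) → Vec Carrier n → Bool
  perp {n} X w = all (λ x → not (X x) ∨ isZero (dot w x)) (allVecs n)

  firstNonzero : {n : ℕ} → Vec Carrier n → Maybe Carrier
  firstNonzero []       = nothing
  firstNonzero (x ∷ xs) = if isZero x then firstNonzero xs else just x

  -- canonical representative of a 1-dimensional subspace:
  -- nonzero with first nonzero entry equal to 1
  isNormalized : {n : ℕ} → Vec Carrier n → Bool
  isNormalized v with firstNonzero v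
  ... | just a  = ⌊ a ≟ 1# ⌋
  ... | nothing = false

  -- P(F^n): the 1-dimensional subspaces, each listed once by its canonical representative
  points : (n : ℕ) → List (Vec Carrier n)
  points n = filterᵇ isNormalized (allVecs n)

record Extension (K L : FiniteField) (d : ℕ) : Set where
  private
    module K = FiniteField K
    module L = FiniteField L
  field
    ι     : K.Carrier → L.Carrier
    ι-+   : ∀ x y → ι (x K.+ y) ≡ ι x L.+ ι y
    ι-*   : ∀ x y → ι (x K.* y) ≡ ι x L.* ι y
    ι-1   : ι K.1# ≡ L.1#
    basis : Vec L.Carrier d
    coord : L.Carrier → Vec K.Carrier d

  expand : Vec K.Carrier d → L.Carrier
  expand a = foldrV L._+_ L.0# (zipWith L._*_ (mapV ι a) basis)

  field
    expand-coord : ∀ x → expand (coord x) ≡ x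
    coord-expand : ∀ a → coord (expand a) ≡ a

module Dual {N : ℕ} (rk : Vec Bool N → ℕ) where
  dualRank : Vec Bool N → ℕ
  dualRank Y = (card Y +ℕ rk (mapV not Y)) ∸ rk (replicate N true)

  dualNullity : Vec Bool N → ℕ
  dualNullity Y = card Y ∸ dualRank Y

-- The setting: F_q ⊆ F_Q ⊆ F_Q̃ with [F_Q : F_q] = m, [F_Q̃ : F_Q] = r,
-- and a code C ⊆ F_Q^n of dimension k given by a generator matrix G
-- (k rows spanning C over F_Q).

module Gabidulin (Fq FQ FQt : FiniteField) (m r n k : ℕ)
                 (E₁ : Extension Fq FQ m) (E₂ : Extension FQ FQt r)
                 (G : Vec (Vec (FiniteField.Carrier FQ) n) k) where
  private
    module q  = LA Fq
    module Q  = LA FQ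
    module Qt = LA FQt
    module E₁ = Extension E₁
    module E₂ = Extension E₂
    Fqⁿ = Vec (FiniteField.Carrier Fq) n
    FQⁿ = Vec (FiniteField.Carrier FQ) n
    FQtⁿ = Vec (FiniteField.Carrier FQt) n

  inC : FQⁿ → Bool
  inC = Q.inSpan G

  Rsupp : FQⁿ → Fqⁿ → Bool
  Rsupp c = q.inSpan (transpose (mapV E₁.coord c))

  C[_] : (Fqⁿ → Bool) → FQⁿ → Bool
  C[ X ] c = inC c ∧ (Rsupp c q.⊆ᵇ X)

  ρ : (Fqⁿ → Bool) → ℕ
  ρ X = k ∸ Q.dim C[ q.perp X ]

  N : ℕ
  N = length (q.points n)

  PE : Vec Fqⁿ N
  PE = fromList (q.points n)

  -- rank function of Cl(M_C): r(S) = ρ_C(⟨S⟩), S ⊆ P(E) given as a mask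
  clRank : Vec Bool N → ℕ
  clRank S = ρ (q.inSpan (fromList (select S PE)))

  n* : Vec Bool N → ℕ
  n* = Dual.dualNullity clRank

  -- C̃ = F_Q̃-span of C, i.e. F_Q̃-row space of G
  inC̃ : FQtⁿ → Bool
  inC̃ = Qt.inSpan (mapV (mapV E₂.ι) G)

  -- F_q-coordinates of an element of F_Q̃ w.r.t. the F_q-basis
  -- { ι₂(b₁ᵢ) b₂ⱼ } of F_Q̃ obtained from the two bases
  coordt : FiniteField.Carrier FQt → Vec (FiniteField.Carrier Fq) (r Data.Nat.* m)
  coordt x = concat (mapV E₁.coord (E₂.coord x))

  rankWeight : FQtⁿ → ℕ
  rankWeight c = q.dim (q.inSpan (transpose (mapV coordt c)))

  A : ℕ
  A = length (filterᵇ (λ c → inC̃ c ∧ ⌊ rankWeight c ≟ℕ n ⌋) (Qt.allVecs n))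

  Q̃ : ℕ
  Q̃ = FiniteField.size FQ Data.Nat.^ r

  RHS : ℤ
  RHS = (-1ℤ ^ℤ N) *ℤ
        sumℤ (mapL (λ γ → (-1ℤ ^ℤ card γ) *ℤ (+ (Q̃ Data.Nat.^ n* γ))) (subsets N))

{-# OPTIONS --safe #-}

-- A codeword c of C̃ has rank weight n exactly when its row support is all of F_q^n, i.e. when no
-- point p ∈ P(E) lies in Rsupp(c)^⊥; and p ∈ Rsupp(c)^⊥ iff c · p = 0 in F_Q̃. Inclusion–exclusion over
-- the set δ ⊆ P(E) of points forced to be orthogonal to c writes A as the alternating sum of the sizes
-- of C̃(⟨δ⟩^⊥). This space is the scalar extension of C(⟨δ⟩^⊥), so it has Q̃^dim C(⟨δ⟩^⊥) elements, and
-- dim C(⟨δ⟩^⊥) = ρ(P(E)) - ρ(δ) is the dual nullity n*(P(E) \ δ). Reindexing the sum by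
-- complements produces the sign (-1)^|P(E)|.

module Submission where

open import Defs
open import Data.Bool using (Bool; true; false; not; _∧_; _∨_; T; T?)
open import Data.Bool.Properties using (T-≡)
open import Data.Bool.ListAction using (any; all)
open import Data.Nat using (ℕ; zero; suc; _⊔_; _≤_; z≤n; s≤s; _∸_)
  renaming (_+_ to _+ℕ_; _^_ to _^ℕ_; _*_ to _*ℕ_; _≟_ to _≟ℕ_)
import Data.Nat.Properties as NP
open import Data.Integer using (ℤ; +_; -1ℤ) renaming (-_ to -ℤ_; _*_ to _*ℤ_; _+_ to _+ℤ_; _^_ to _^ℤ_)
import Data.Integer.Properties as IP
open import Data.Integer.Tactic.RingSolver using (solve-∀)
open import Data.List using (List; []; _∷_; length; concatMap; filterᵇ; upTo; _++_)
  renaming (map to mapL; foldr to foldrL)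
import Data.List.Properties as LP
open import Data.Vec using (Vec; []; _∷_; replicate; zipWith; transpose; toList; fromList; concat; _⊛_)
  renaming (map to mapV; _++_ to _++ᵛ_)
import Data.Vec.Properties as VP
open import Data.Maybe using (Maybe; just; nothing)
open import Data.Product using (∃; _×_; _,_; proj₁; proj₂)
open import Data.Sum using (_⊎_; inj₁; inj₂; [_,_]′)
open import Data.Empty using (⊥; ⊥-elim)
open import Data.List.Membership.Propositional using (_∈_)
open import Data.List.Membership.Propositional.Properties
  using (∈-∃++; ∈-map⁺; ∈-map⁻; ∈-++⁺ˡ; ∈-++⁺ʳ; ∈-++⁻; ∈-upTo⁺; ∈-upTo⁻; ∈-filter⁺; ∈-filter⁻; foldr-selective)
open import Data.List.Relation.Unary.Any using (here; there)
import Data.List.Relation.Unary.All as All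
open All using ([]; _∷_)
open import Data.List.Relation.Unary.AllPairs using ([]; _∷_)
open import Data.List.Relation.Unary.Unique.Propositional using (Unique)
import Data.List.Relation.Unary.Unique.Propositional.Properties as Unique
open import Function using (_∘_; Equivalence)
open import Relation.Binary.PropositionalEquality
  using (_≡_; _≢_; refl; sym; trans; cong; cong₂; subst; subst₂; module ≡-Reasoning)
open import Relation.Nullary using (yes; no)
open import Relation.Binary.Definitions using (DecidableEquality)
open import Relation.Nullary.Decidable using (⌊_⌋)
open import Level using (0ℓ)
open import Algebra.Bundles using (CommutativeRing)
open import Algebra.Structures using (IsCommutativeRing)
import Algebra.Properties.Ring as RingProperties
import Algebra.Properties.CommutativeSemigroup as CommutativeSemigroupProperties

bool-ext : {b c : Bool} → (b ≡ true → c ≡ true) → (c ≡ true → b ≡ true) → b ≡ c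
bool-ext {false} {false} f g = refl
bool-ext {false} {true}  f g = g refl
bool-ext {true}  {false} f g = sym (f refl)
bool-ext {true}  {true}  f g = refl

∧-elim : {b c : Bool} → b ∧ c ≡ true → (b ≡ true) × (c ≡ true)
∧-elim {true} {true} _ = refl , refl

∧-intro : {b c : Bool} → b ≡ true → c ≡ true → b ∧ c ≡ true
∧-intro refl refl = refl

∨-elim : {b c : Bool} → b ∨ c ≡ true → (b ≡ true) ⊎ (c ≡ true)
∨-elim {true}          _ = inj₁ refl
∨-elim {false} {true}  _ = inj₂ refl

not-true⇒false : {b : Bool} → not b ≡ true → b ≡ false
not-true⇒false {false} _ = refl

true≢false : {b : Bool} → b ≡ true → b ≡ false → ⊥
true≢false refl ()

module _ {A : Set} where
  any⁻ : (p : A → Bool) (xs : List A) → any p xs ≡ true → ∃ λ x → x ∈ xs × p x ≡ true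
  any⁻ p (x ∷ xs) h with p x in eq
  ... | true  = x , here refl , eq
  ... | false with any⁻ p xs h
  ...   | y , y∈ , py = y , there y∈ , py

  any⁺ : (p : A → Bool) {xs : List A} {x : A} → x ∈ xs → p x ≡ true → any p xs ≡ true
  any⁺ p {x ∷ xs} (here refl) px rewrite px = refl
  any⁺ p {y ∷ xs} (there x∈) px with p y
  ... | true  = refl
  ... | false = any⁺ p x∈ px

  all⁻ : (p : A → Bool) {xs : List A} → all p xs ≡ true → ∀ {x} → x ∈ xs → p x ≡ true
  all⁻ p {y ∷ xs} h (here refl) = proj₁ (∧-elim h)
  all⁻ p {y ∷ xs} h (there x∈)  = all⁻ p (proj₂ (∧-elim {p y} h)) x∈

  all⁺ : (p : A → Bool) (xs : List A) → (∀ {x} → x ∈ xs → p x ≡ true) → all p xs ≡ true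
  all⁺ p []       f = refl
  all⁺ p (x ∷ xs) f = ∧-intro (f (here refl)) (all⁺ p xs (f ∘ there))

  all-false⇒∃ : (p : A → Bool) (xs : List A) → all p xs ≡ false → ∃ λ x → x ∈ xs × p x ≡ false
  all-false⇒∃ p (x ∷ xs) h with p x in eq
  ... | false = x , here refl , eq
  ... | true with all-false⇒∃ p xs h
  ...   | y , y∈ , py = y , there y∈ , py

  filterᵇ-∈⁻ : (p : A → Bool) {xs : List A} {x : A} → x ∈ filterᵇ p xs → x ∈ xs × p x ≡ true
  filterᵇ-∈⁻ p x∈ = let (x∈xs , px) = ∈-filter⁻ (T? ∘ p) x∈ in x∈xs , Equivalence.to T-≡ px

  filterᵇ-∈⁺ : (p : A → Bool) {xs : List A} {x : A} → x ∈ xs → p x ≡ true → x ∈ filterᵇ p xs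
  filterᵇ-∈⁺ p x∈ px = ∈-filter⁺ (T? ∘ p) x∈ (Equivalence.from T-≡ px)

  filterᵇ-cong : (p q : A → Bool) → (∀ x → p x ≡ q x) → (xs : List A) → filterᵇ p xs ≡ filterᵇ q xs
  filterᵇ-cong p q e = LP.filter-≐ (T? ∘ p) (T? ∘ q) ((λ {x} → subst T (e x)) , (λ {x} → subst T (sym (e x))))

  filterᵇ-unique : (p : A → Bool) {xs : List A} → Unique xs → Unique (filterᵇ p xs)
  filterᵇ-unique p = Unique.filter⁺ (T? ∘ p)

  private
    ∈-++-remove : {x y : A} (ys zs : List A) → y ∈ ys ++ x ∷ zs → y ≢ x → y ∈ ys ++ zs
    ∈-++-remove []       zs (here refl) ne = ⊥-elim (ne refl)
    ∈-++-remove []       zs (there y∈)  ne = y∈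
    ∈-++-remove (w ∷ ys) zs (here refl) ne = here refl
    ∈-++-remove (w ∷ ys) zs (there y∈)  ne = there (∈-++-remove ys zs y∈ ne)

  Unique-⊆⇒length≤ : {xs ys : List A} → Unique xs → (∀ {z} → z ∈ xs → z ∈ ys) → length xs ≤ length ys
  Unique-⊆⇒length≤ {[]}     u        sub = z≤n
  Unique-⊆⇒length≤ {x ∷ xs} {ys} (x∉ ∷ u) sub with ∈-∃++ (sub (here refl))
  ... | ys₁ , zs₁ , refl = begin
    suc (length xs)               ≤⟨ s≤s (Unique-⊆⇒length≤ u (λ z∈ → ∈-++-remove ys₁ zs₁ (sub (there z∈)) (x≢z z∈ ∘ sym))) ⟩
    suc (length (ys₁ ++ zs₁))     ≡⟨ cong suc (LP.length-++ ys₁) ⟩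
    suc (length ys₁ +ℕ length zs₁) ≡⟨ sym (NP.+-suc (length ys₁) (length zs₁)) ⟩
    length ys₁ +ℕ length (x ∷ zs₁) ≡⟨ sym (LP.length-++ ys₁) ⟩
    length (ys₁ ++ x ∷ zs₁)       ∎
    where
    open NP.≤-Reasoning
    x≢z : ∀ {z} → z ∈ xs → x ≢ z
    x≢z z∈ = All.lookup x∉ z∈

  Unique-⊆⊇⇒length≡ : {xs ys : List A} → Unique xs → Unique ys →
                      (∀ {z} → z ∈ xs → z ∈ ys) → (∀ {z} → z ∈ ys → z ∈ xs) → length xs ≡ length ys
  Unique-⊆⊇⇒length≡ u v f g = NP.≤-antisym (Unique-⊆⇒length≤ u f) (Unique-⊆⇒length≤ v g)

module _ {A : Set} where
  vecsOver-complete : (xs : List A) → (∀ x → x ∈ xs) → {n : ℕ} (v : Vec A n) → v ∈ vecsOver xs n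
  vecsOver-complete xs c [] = here refl
  vecsOver-complete xs c {suc n} (x ∷ v) = go xs (c x)
    where
    go : (ys : List A) → x ∈ ys → (x ∷ v) ∈ concatMap (λ y → mapL (y ∷_) (vecsOver xs n)) ys
    go (y ∷ ys) (here refl) = ∈-++⁺ˡ (∈-map⁺ (x ∷_) (vecsOver-complete xs c v))
    go (y ∷ ys) (there x∈)  = ∈-++⁺ʳ (mapL (y ∷_) (vecsOver xs n)) (go ys x∈)

  length-vecsOver : (xs : List A) (n : ℕ) → length (vecsOver xs n) ≡ length xs ^ℕ n
  length-vecsOver xs zero    = refl
  length-vecsOver xs (suc n) = go xs
    where
    go : (ys : List A) → length (concatMap (λ y → mapL (y ∷_) (vecsOver xs n)) ys) ≡ length ys *ℕ length xs ^ℕ n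
    go []       = refl
    go (y ∷ ys) = trans (LP.length-++ (mapL (y ∷_) (vecsOver xs n)))
                        (cong₂ _+ℕ_ (trans (LP.length-map (y ∷_) (vecsOver xs n)) (length-vecsOver xs n)) (go ys))

  vecsOver-unique : (xs : List A) → Unique xs → (n : ℕ) → Unique (vecsOver xs n)
  vecsOver-unique xs u zero    = [] ∷ []
  vecsOver-unique xs u (suc n) = go xs u
    where
    V : List (Vec A n)
    V = vecsOver xs n
    head∈ : {ys : List A} {w : Vec A (suc n)} → w ∈ concatMap (λ z → mapL (z ∷_) V) ys → Data.Vec.head w ∈ ys
    head∈ {z ∷ ys} w∈ with ∈-++⁻ (mapL (z ∷_) V) w∈
    ... | inj₁ w∈₁ = let (_ , _ , eq) = ∈-map⁻ (z ∷_) w∈₁ in here (cong Data.Vec.head eq)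
    ... | inj₂ w∈₂ = there (head∈ w∈₂)
    go : (ys : List A) → Unique ys → Unique (concatMap (λ z → mapL (z ∷_) V) ys)
    go []       _          = []
    go (y ∷ ys) (y∉ ∷ uys) =
      Unique.++⁺ (Unique.map⁺ VP.∷-injectiveʳ (vecsOver-unique xs u n)) (go ys uys)
        λ (w∈₁ , w∈₂) → let (_ , _ , eq) = ∈-map⁻ (y ∷_) w∈₁
                        in All.lookup y∉ (head∈ w∈₂) (sym (cong Data.Vec.head eq))

Vec₀-≡[] : {A : Set} (v : Vec A 0) → v ≡ []
Vec₀-≡[] [] = refl

module _ {A : Set} (_≟_ : DecidableEquality A) {x y : A} where
  ⌊≟⌋-true⇒≡ : ⌊ x ≟ y ⌋ ≡ true → x ≡ y
  ⌊≟⌋-true⇒≡ h with x ≟ y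
  ... | yes e = e

  ⌊≟⌋-false⇒≢ : ⌊ x ≟ y ⌋ ≡ false → x ≢ y
  ⌊≟⌋-false⇒≢ h with x ≟ y
  ... | no ne = ne

  ≡⇒⌊≟⌋-true : x ≡ y → ⌊ x ≟ y ⌋ ≡ true
  ≡⇒⌊≟⌋-true e with x ≟ y
  ... | yes _ = refl
  ... | no ne = ⊥-elim (ne e)

  ≢⇒⌊≟⌋-false : x ≢ y → ⌊ x ≟ y ⌋ ≡ false
  ≢⇒⌊≟⌋-false ne with x ≟ y
  ... | yes e = ⊥-elim (ne e)
  ... | no _ = refl

foldr-⊔-lub : (xs : List ℕ) (b : ℕ) → (∀ {x} → x ∈ xs → x ≤ b) → foldrL _⊔_ 0 xs ≤ b
foldr-⊔-lub []       b f = z≤n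
foldr-⊔-lub (x ∷ xs) b f = NP.⊔-lub (f (here refl)) (foldr-⊔-lub xs b (f ∘ there))

foldr-⊔-upper : (xs : List ℕ) {x : ℕ} → x ∈ xs → x ≤ foldrL _⊔_ 0 xs
foldr-⊔-upper (y ∷ xs) (here refl) = NP.m≤m⊔n y _
foldr-⊔-upper (y ∷ xs) (there x∈)  = NP.≤-trans (foldr-⊔-upper xs x∈) (NP.m≤n⊔m y _)

foldr-⊔-∈ : (xs : List ℕ) → 0 ∈ xs → foldrL _⊔_ 0 xs ∈ xs
foldr-⊔-∈ xs 0∈ with foldr-selective NP.⊔-sel 0 xs
... | inj₁ e = subst (_∈ xs) (sym e) 0∈
... | inj₂ m = m

module VectorSpace (F : FiniteField) where
  open FiniteField F hiding (_+_; _*_; -_)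
  open LA F public
  infixl 6 _+_
  infixl 7 _*_
  infix 8 -_
  _+_ : Carrier → Carrier → Carrier
  _+_ = FiniteField._+_ F
  _*_ : Carrier → Carrier → Carrier
  _*_ = FiniteField._*_ F
  -_ : Carrier → Carrier
  -_ = FiniteField.-_ F
  open IsCommutativeRing isCommutativeRing
    using (+-assoc; *-assoc; *-comm; +-identityˡ; +-identityʳ; *-identityˡ; *-identityʳ;
           distribˡ; distribʳ; zeroˡ; zeroʳ; -‿inverseʳ)
  open ≡-Reasoning

  commutativeRing : CommutativeRing 0ℓ 0ℓ
  commutativeRing = record { isCommutativeRing = isCommutativeRing }

  open RingProperties (CommutativeRing.ring commutativeRing) using (-1*x≈-x; -‿involutive; +-identityˡ-unique)
  open CommutativeSemigroupProperties (CommutativeRing.+-commutativeSemigroup commutativeRing) using () renaming (interchange to +-interchange)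

  C : Set
  C = Carrier

  isZero-true : {x : C} → isZero x ≡ true → x ≡ 0#
  isZero-true = ⌊≟⌋-true⇒≡ _≟_

  isZero-false : {x : C} → isZero x ≡ false → x ≢ 0#
  isZero-false = ⌊≟⌋-false⇒≢ _≟_

  isZero-≡ : {x : C} → x ≡ 0# → isZero x ≡ true
  isZero-≡ = ≡⇒⌊≟⌋-true _≟_

  isZero-≢ : {x : C} → x ≢ 0# → isZero x ≡ false
  isZero-≢ = ≢⇒⌊≟⌋-false _≟_

  isZeroV-true : {n : ℕ} {v : Vec C n} → isZeroV v ≡ true → v ≡ zeroV
  isZeroV-true = ⌊≟⌋-true⇒≡ _≟V_

  isZeroV-≡ : {n : ℕ} {v : Vec C n} → v ≡ zeroV → isZeroV v ≡ true
  isZeroV-≡ = ≡⇒⌊≟⌋-true _≟V_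

  isZeroV-false : {n : ℕ} {v : Vec C n} → isZeroV v ≡ false → v ≢ zeroV
  isZeroV-false = ⌊≟⌋-false⇒≢ _≟V_

  inv : (x : C) → x ≢ 0# → C
  inv x nz = proj₁ (inverse x nz)

  inv-r : (x : C) (nz : x ≢ 0#) → x * inv x nz ≡ 1#
  inv-r x nz = proj₂ (inverse x nz)

  inv-l : (x : C) (nz : x ≢ 0#) → inv x nz * x ≡ 1#
  inv-l x nz = trans (*-comm _ x) (inv-r x nz)

  x*y≡0⇒y≡0 : {x y : C} → x ≢ 0# → x * y ≡ 0# → y ≡ 0#
  x*y≡0⇒y≡0 {x} {y} nz e = begin
    y ≡⟨ sym (*-identityˡ y) ⟩
    1# * y ≡⟨ cong (_* y) (sym (inv-l x nz)) ⟩
    (inv x nz * x) * y ≡⟨ *-assoc _ x y ⟩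
    inv x nz * (x * y) ≡⟨ cong (inv x nz *_) e ⟩
    inv x nz * 0# ≡⟨ zeroʳ _ ⟩
    0# ∎

  1≢0 : 1# ≢ 0#
  1≢0 e = 0≢1 (sym e)

  x+-1*x≡0 : (x : C) → x + ((- 1#) * x) ≡ 0#
  x+-1*x≡0 x = trans (cong (λ z → x + z) (-1*x≈-x x)) (-‿inverseʳ x)

  infixl 6 _⊕_
  infixr 7 _⊙_
  _⊕_ : {n : ℕ} → Vec C n → Vec C n → Vec C n
  u ⊕ v = zipWith _+_ u v

  _⊙_ : {n : ℕ} → C → Vec C n → Vec C n
  a ⊙ v = mapV (a *_) v

  ⊕-identityˡ : {n : ℕ} (v : Vec C n) → zeroV ⊕ v ≡ v
  ⊕-identityˡ [] = refl
  ⊕-identityˡ (x ∷ v) = cong₂ _∷_ (+-identityˡ x) (⊕-identityˡ v)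

  ⊕-identityʳ : {n : ℕ} (v : Vec C n) → v ⊕ zeroV ≡ v
  ⊕-identityʳ [] = refl
  ⊕-identityʳ (x ∷ v) = cong₂ _∷_ (+-identityʳ x) (⊕-identityʳ v)

  ⊕-assoc : {n : ℕ} (u v w : Vec C n) → (u ⊕ v) ⊕ w ≡ u ⊕ (v ⊕ w)
  ⊕-assoc [] [] [] = refl
  ⊕-assoc (x ∷ u) (y ∷ v) (z ∷ w) = cong₂ _∷_ (+-assoc x y z) (⊕-assoc u v w)

  ⊕-interchange : {n : ℕ} (a b c d : Vec C n) → (a ⊕ b) ⊕ (c ⊕ d) ≡ (a ⊕ c) ⊕ (b ⊕ d)
  ⊕-interchange [] [] [] [] = refl
  ⊕-interchange (a ∷ as) (b ∷ bs) (c ∷ cs) (d ∷ ds) = cong₂ _∷_ (+-interchange a b c d) (⊕-interchange as bs cs ds)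

  ⊙-zeroV : {n : ℕ} (a : C) → a ⊙ zeroV {n} ≡ zeroV
  ⊙-zeroV {zero} a = refl
  ⊙-zeroV {suc n} a = cong₂ _∷_ (zeroʳ a) (⊙-zeroV a)

  0⊙ : {n : ℕ} (v : Vec C n) → 0# ⊙ v ≡ zeroV
  0⊙ [] = refl
  0⊙ (x ∷ v) = cong₂ _∷_ (zeroˡ x) (0⊙ v)

  1⊙ : {n : ℕ} (v : Vec C n) → 1# ⊙ v ≡ v
  1⊙ [] = refl
  1⊙ (x ∷ v) = cong₂ _∷_ (*-identityˡ x) (1⊙ v)

  ⊙-⊕ : {n : ℕ} (a : C) (u v : Vec C n) → a ⊙ (u ⊕ v) ≡ a ⊙ u ⊕ a ⊙ v
  ⊙-⊕ a [] [] = refl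
  ⊙-⊕ a (x ∷ u) (y ∷ v) = cong₂ _∷_ (distribˡ a x y) (⊙-⊕ a u v)

  +-⊙ : {n : ℕ} (a b : C) (v : Vec C n) → (a + b) ⊙ v ≡ a ⊙ v ⊕ b ⊙ v
  +-⊙ a b [] = refl
  +-⊙ a b (x ∷ v) = cong₂ _∷_ (distribʳ x a b) (+-⊙ a b v)

  ⊙-⊙ : {n : ℕ} (a b : C) (v : Vec C n) → a ⊙ (b ⊙ v) ≡ (a * b) ⊙ v
  ⊙-⊙ a b [] = refl
  ⊙-⊙ a b (x ∷ v) = cong₂ _∷_ (sym (*-assoc a b x)) (⊙-⊙ a b v)

  v⊕-1⊙v≡0 : {n : ℕ} (v : Vec C n) → v ⊕ (- 1#) ⊙ v ≡ zeroV
  v⊕-1⊙v≡0 [] = refl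
  v⊕-1⊙v≡0 (x ∷ v) = cong₂ _∷_ (x+-1*x≡0 x) (v⊕-1⊙v≡0 v)

  u⊕v≡0⇒u≡-1⊙v : {n : ℕ} (u v : Vec C n) → u ⊕ v ≡ zeroV → u ≡ (- 1#) ⊙ v
  u⊕v≡0⇒u≡-1⊙v u v e = begin
    u ≡⟨ sym (⊕-identityʳ u) ⟩
    u ⊕ zeroV ≡⟨ cong (u ⊕_) (sym (v⊕-1⊙v≡0 v)) ⟩
    u ⊕ (v ⊕ (- 1#) ⊙ v) ≡⟨ sym (⊕-assoc u v _) ⟩
    (u ⊕ v) ⊕ (- 1#) ⊙ v ≡⟨ cong (_⊕ ((- 1#) ⊙ v)) e ⟩
    zeroV ⊕ (- 1#) ⊙ v ≡⟨ ⊕-identityˡ _ ⟩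
    (- 1#) ⊙ v ∎

  u⊕-1⊙v≡0⇒u≡v : {n : ℕ} (u v : Vec C n) → u ⊕ (- 1#) ⊙ v ≡ zeroV → u ≡ v
  u⊕-1⊙v≡0⇒u≡v u v e = trans (u⊕v≡0⇒u≡-1⊙v u _ e) (trans (⊙-⊙ (- 1#) (- 1#) v) (trans (cong (_⊙ v) -1*-1≡1) (1⊙ v)))
    where
    -1*-1≡1 : (- 1#) * (- 1#) ≡ 1#
    -1*-1≡1 = trans (-1*x≈-x (- 1#)) (-‿involutive 1#)

  lincomb-⊕ : {n d : ℕ} (a b : Vec C d) (vs : Vec (Vec C n) d) → lincomb (a ⊕ b) vs ≡ lincomb a vs ⊕ lincomb b vs
  lincomb-⊕ [] [] [] = sym (⊕-identityˡ zeroV)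
  lincomb-⊕ (a ∷ as) (b ∷ bs) (v ∷ vs) = begin
    (a + b) ⊙ v ⊕ lincomb (as ⊕ bs) vs ≡⟨ cong₂ _⊕_ (+-⊙ a b v) (lincomb-⊕ as bs vs) ⟩
    (a ⊙ v ⊕ b ⊙ v) ⊕ (lincomb as vs ⊕ lincomb bs vs) ≡⟨ ⊕-interchange _ _ _ _ ⟩
    (a ⊙ v ⊕ lincomb as vs) ⊕ (b ⊙ v ⊕ lincomb bs vs) ∎

  lincomb-⊙ : {n d : ℕ} (c : C) (a : Vec C d) (vs : Vec (Vec C n) d) → lincomb (c ⊙ a) vs ≡ c ⊙ lincomb a vs
  lincomb-⊙ c [] [] = sym (⊙-zeroV c)
  lincomb-⊙ c (a ∷ as) (v ∷ vs) = begin
    (c * a) ⊙ v ⊕ lincomb (c ⊙ as) vs ≡⟨ cong₂ _⊕_ (sym (⊙-⊙ c a v)) (lincomb-⊙ c as vs) ⟩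
    c ⊙ (a ⊙ v) ⊕ c ⊙ lincomb as vs ≡⟨ sym (⊙-⊕ c _ _) ⟩
    c ⊙ (a ⊙ v ⊕ lincomb as vs) ∎

  lincomb-0 : {n d : ℕ} (vs : Vec (Vec C n) d) → lincomb zeroV vs ≡ zeroV
  lincomb-0 [] = refl
  lincomb-0 (v ∷ vs) = trans (cong₂ _⊕_ (0⊙ v) (lincomb-0 vs)) (⊕-identityˡ zeroV)

  lincomb-∘ : {n k d : ℕ} (l : Vec C d) (A : Vec (Vec C k) d) (G : Vec (Vec C n) k) →
              lincomb l (mapV (λ a → lincomb a G) A) ≡ lincomb (lincomb l A) G
  lincomb-∘ [] [] G = sym (lincomb-0 G)
  lincomb-∘ (l ∷ ls) (a ∷ A) G = begin
    l ⊙ lincomb a G ⊕ lincomb ls (mapV (λ a → lincomb a G) A) ≡⟨ cong₂ _⊕_ (sym (lincomb-⊙ l a G)) (lincomb-∘ ls A G) ⟩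
    lincomb (l ⊙ a) G ⊕ lincomb (lincomb ls A) G ≡⟨ sym (lincomb-⊕ (l ⊙ a) (lincomb ls A) G) ⟩
    lincomb (l ⊙ a ⊕ lincomb ls A) G ∎

  lincomb-injective : {n d : ℕ} (vs : Vec (Vec C n) d) → LinIndep vs → {a b : Vec C d} → lincomb a vs ≡ lincomb b vs → a ≡ b
  lincomb-injective vs li {a} {b} e = u⊕-1⊙v≡0⇒u≡v a b (li _ (begin
    lincomb (a ⊕ (- 1#) ⊙ b) vs ≡⟨ lincomb-⊕ a _ vs ⟩
    lincomb a vs ⊕ lincomb ((- 1#) ⊙ b) vs ≡⟨ cong (lincomb a vs ⊕_) (lincomb-⊙ (- 1#) b vs) ⟩
    lincomb a vs ⊕ (- 1#) ⊙ lincomb b vs ≡⟨ cong (λ z → z ⊕ (- 1#) ⊙ lincomb b vs) e ⟩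
    lincomb b vs ⊕ (- 1#) ⊙ lincomb b vs ≡⟨ v⊕-1⊙v≡0 _ ⟩
    zeroV ∎))

  dot-comm : {n : ℕ} (u v : Vec C n) → dot u v ≡ dot v u
  dot-comm [] [] = refl
  dot-comm (x ∷ u) (y ∷ v) = cong₂ _+_ (*-comm x y) (dot-comm u v)

  dot-zeroˡ : {n : ℕ} (v : Vec C n) → dot zeroV v ≡ 0#
  dot-zeroˡ [] = refl
  dot-zeroˡ (x ∷ v) = trans (cong₂ _+_ (zeroˡ x) (dot-zeroˡ v)) (+-identityˡ 0#)

  dot-zeroʳ : {n : ℕ} (v : Vec C n) → dot v zeroV ≡ 0#
  dot-zeroʳ v = trans (dot-comm v zeroV) (dot-zeroˡ v)

  dot-⊕ˡ : {n : ℕ} (u v w : Vec C n) → dot (u ⊕ v) w ≡ dot u w + dot v w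
  dot-⊕ˡ [] [] [] = sym (+-identityˡ 0#)
  dot-⊕ˡ (x ∷ u) (y ∷ v) (z ∷ w) = begin
    (x + y) * z + dot (u ⊕ v) w ≡⟨ cong₂ _+_ (distribʳ z x y) (dot-⊕ˡ u v w) ⟩
    (x * z + y * z) + (dot u w + dot v w) ≡⟨ +-interchange _ _ _ _ ⟩
    (x * z + dot u w) + (y * z + dot v w) ∎

  dot-⊙ˡ : {n : ℕ} (a : C) (u w : Vec C n) → dot (a ⊙ u) w ≡ a * dot u w
  dot-⊙ˡ a [] [] = sym (zeroʳ a)
  dot-⊙ˡ a (x ∷ u) (z ∷ w) = begin
    (a * x) * z + dot (a ⊙ u) w ≡⟨ cong₂ _+_ (*-assoc a x z) (dot-⊙ˡ a u w) ⟩
    a * (x * z) + a * dot u w ≡⟨ sym (distribˡ a _ _) ⟩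
    a * (x * z + dot u w) ∎

  dot-⊕ʳ : {n : ℕ} (w u v : Vec C n) → dot w (u ⊕ v) ≡ dot w u + dot w v
  dot-⊕ʳ w u v = trans (dot-comm w _) (trans (dot-⊕ˡ u v w) (cong₂ _+_ (dot-comm u w) (dot-comm v w)))

  dot-⊙ʳ : {n : ℕ} (a : C) (w u : Vec C n) → dot w (a ⊙ u) ≡ a * dot w u
  dot-⊙ʳ a w u = trans (dot-comm w _) (trans (dot-⊙ˡ a u w) (cong (a *_) (dot-comm u w)))

  dot-lincombˡ : {n d : ℕ} (a : Vec C d) (vs : Vec (Vec C n) d) (x : Vec C n) →
                 dot (lincomb a vs) x ≡ dot a (mapV (λ v → dot v x) vs)
  dot-lincombˡ [] [] x = dot-zeroˡ x
  dot-lincombˡ (a ∷ as) (v ∷ vs) x = trans (dot-⊕ˡ (a ⊙ v) (lincomb as vs) x) (cong₂ _+_ (dot-⊙ˡ a v x) (dot-lincombˡ as vs x))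

  dot-lincombʳ : {n d : ℕ} (x : Vec C n) (a : Vec C d) (vs : Vec (Vec C n) d) →
                 dot x (lincomb a vs) ≡ dot a (mapV (dot x) vs)
  dot-lincombʳ x a vs = trans (dot-comm x _) (trans (dot-lincombˡ a vs x) (cong (dot a) (VP.map-cong (λ v → dot-comm v x) vs)))

  dot-nondegenerate : {n : ℕ} (x : Vec C n) → (∀ y → dot y x ≡ 0#) → x ≡ zeroV
  dot-nondegenerate [] h = refl
  dot-nondegenerate (x ∷ xs) h =
    cong₂ _∷_ e0 (dot-nondegenerate xs (λ y → trans (sym (trans (cong (λ z → z + dot y xs) (zeroˡ x)) (+-identityˡ _))) (h (0# ∷ y))))
    where
    e0 : x ≡ 0#
    e0 = trans (sym (trans (cong₂ _+_ (*-identityˡ x) (dot-zeroˡ xs)) (+-identityʳ x))) (h (1# ∷ zeroV))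

  ⊛-zip : {A : Set} {n m : ℕ} (v : Vec A n) (T : Vec (Vec A m) n) → ((replicate n Data.Vec._∷_ ⊛ v) ⊛ T) ≡ zipWith Data.Vec._∷_ v T
  ⊛-zip [] [] = refl
  ⊛-zip (x ∷ v) (t ∷ T) = cong (_ ∷_) (⊛-zip v T)

  transpose-∷ : {A : Set} {n m : ℕ} (v : Vec A n) (M : Vec (Vec A n) m) → transpose (v ∷ M) ≡ zipWith Data.Vec._∷_ v (transpose M)
  transpose-∷ v M = ⊛-zip v (transpose M)

  lincomb-zip∷ : {n e : ℕ} (b : Vec C e) (m : Vec C e) (T : Vec (Vec C n) e) →
                 lincomb b (zipWith Data.Vec._∷_ m T) ≡ dot b m ∷ lincomb b T
  lincomb-zip∷ [] [] [] = refl
  lincomb-zip∷ (b ∷ bs) (m ∷ ms) (t ∷ T) rewrite lincomb-zip∷ bs ms T = refl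

  lincomb-transpose : {n e : ℕ} (b : Vec C e) (M : Vec (Vec C e) n) → lincomb b (transpose M) ≡ mapV (dot b) M
  lincomb-transpose b [] = Vec₀-≡[] _
  lincomb-transpose b (m ∷ M) =
    trans (cong (lincomb b) (transpose-∷ m M)) (trans (lincomb-zip∷ b m (transpose M)) (cong (dot b m ∷_) (lincomb-transpose b M)))

  allVecs-∈ : {n : ℕ} (v : Vec C n) → v ∈ allVecs n
  allVecs-∈ v = vecsOver-complete elements elements-complete v

  allVecs-unique : (n : ℕ) → Unique (allVecs n)
  allVecs-unique n = vecsOver-unique elements elements-unique n

  length-allVecs : (n : ℕ) → length (allVecs n) ≡ size ^ℕ n
  length-allVecs n = length-vecsOver elements n

  inSpan⁻ : {n d : ℕ} (vs : Vec (Vec C n) d) {w : Vec C n} → inSpan vs w ≡ true → ∃ λ a → lincomb a vs ≡ w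
  inSpan⁻ {d = d} vs {w} h = let (a , _ , e) = any⁻ (λ a → ⌊ lincomb a vs ≟V w ⌋) (allVecs d) h in a , ⌊≟⌋-true⇒≡ _≟V_ e

  inSpan⁺ : {n d : ℕ} (vs : Vec (Vec C n) d) (a : Vec C d) → inSpan vs (lincomb a vs) ≡ true
  inSpan⁺ {d = d} vs a = any⁺ (λ a' → ⌊ lincomb a' vs ≟V lincomb a vs ⌋) (allVecs-∈ a) (≡⇒⌊≟⌋-true _≟V_ refl)

  isIndep⁻ : {n d : ℕ} (vs : Vec (Vec C n) d) → isIndep vs ≡ true → LinIndep vs
  isIndep⁻ {d = d} vs h a e with ∨-elim (all⁻ (λ a → not (isZeroV (lincomb a vs)) ∨ isZeroV a) h (allVecs-∈ a))
  ... | inj₁ x = ⊥-elim (true≢false (isZeroV-≡ e) (not-true⇒false x))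
  ... | inj₂ y = isZeroV-true y

  isIndep⁺ : {n d : ℕ} (vs : Vec (Vec C n) d) → LinIndep vs → isIndep vs ≡ true
  isIndep⁺ {d = d} vs li = all⁺ _ (allVecs d) (λ {a} _ → go a)
    where
    go : (a : Vec C d) → not (isZeroV (lincomb a vs)) ∨ isZeroV a ≡ true
    go a with isZeroV (lincomb a vs) in eq
    ... | false = refl
    ... | true = isZeroV-≡ (li a (isZeroV-true eq))

  isIndep-false : {n d : ℕ} (vs : Vec (Vec C n) d) → isIndep vs ≡ false → ∃ λ a → lincomb a vs ≡ zeroV × a ≢ zeroV
  isIndep-false {d = d} vs h with all-false⇒∃ (λ a → not (isZeroV (lincomb a vs)) ∨ isZeroV a) (allVecs d) h
  ... | a , _ , e with isZeroV (lincomb a vs) in eq1 | isZeroV a in eq2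
  ... | true | false = a , isZeroV-true eq1 , isZeroV-false eq2

  hasIndep⁻ : {n d : ℕ} (X : Vec C n → Bool) → hasIndepFamily X d ≡ true →
              ∃ λ (vs : Vec (Vec C n) d) → LinIndep vs × all X (toList vs) ≡ true
  hasIndep⁻ {n} {d} X h with any⁻ (λ vs → isIndep vs ∧ all X (toList vs)) (vecsOver (allVecs n) d) h
  ... | vs , _ , e = vs , isIndep⁻ vs (proj₁ (∧-elim e)) , proj₂ (∧-elim {isIndep vs} e)

  hasIndep⁺ : {n d : ℕ} (X : Vec C n → Bool) (vs : Vec (Vec C n) d) → LinIndep vs → all X (toList vs) ≡ true → hasIndepFamily X d ≡ true
  hasIndep⁺ {n} {d} X vs li h = any⁺ (λ vs → isIndep vs ∧ all X (toList vs))
    (vecsOver-complete (allVecs n) allVecs-∈ vs) (∧-intro (isIndep⁺ vs li) h)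

  perp⁻ : {n : ℕ} (X : Vec C n → Bool) {w : Vec C n} → perp X w ≡ true → ∀ x → X x ≡ true → dot w x ≡ 0#
  perp⁻ {n} X {w} h x hx with ∨-elim (all⁻ (λ x → not (X x) ∨ isZero (dot w x)) h (allVecs-∈ x))
  ... | inj₁ e = ⊥-elim (true≢false hx (not-true⇒false e))
  ... | inj₂ e = isZero-true e

  perp⁺ : {n : ℕ} (X : Vec C n → Bool) (w : Vec C n) → (∀ x → X x ≡ true → dot w x ≡ 0#) → perp X w ≡ true
  perp⁺ {n} X w f = all⁺ _ (allVecs n) (λ {x} _ → go x)
    where
    go : ∀ x → not (X x) ∨ isZero (dot w x) ≡ true
    go x with X x in eq
    ... | false = refl
    ... | true = isZero-≡ (f x eq)

  ⊆⁻ : {n : ℕ} (X Y : Vec C n → Bool) → (X ⊆ᵇ Y) ≡ true → ∀ w → X w ≡ true → Y w ≡ true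
  ⊆⁻ {n} X Y h w hw with ∨-elim (all⁻ (λ w → not (X w) ∨ Y w) h (allVecs-∈ w))
  ... | inj₁ e = ⊥-elim (true≢false hw (not-true⇒false e))
  ... | inj₂ e = e

  ⊆⁺ : {n : ℕ} (X Y : Vec C n → Bool) → (∀ w → X w ≡ true → Y w ≡ true) → (X ⊆ᵇ Y) ≡ true
  ⊆⁺ {n} X Y f = all⁺ _ (allVecs n) (λ {w} _ → go w)
    where
    go : ∀ w → not (X w) ∨ Y w ≡ true
    go w with X w in eq
    ... | false = refl
    ... | true = f w eq

  SpanPerp : {n k : ℕ} {Y : Set} → Vec (Vec C n) k → List Y → (Y → Vec C n) → Vec C n → Set
  SpanPerp G ps t w = (∃ λ a → lincomb a G ≡ w) × (∀ {p} → p ∈ ps → dot w (t p) ≡ 0#)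

  2≤size : 2 ≤ size
  2≤size = Unique-⊆⇒length≤ {xs = 0# ∷ 1# ∷ []} ((0≢1 ∷ []) ∷ [] ∷ []) (λ {z} _ → elements-complete z)

  spanList : {n d : ℕ} → Vec (Vec C n) d → List (Vec C n)
  spanList {d = d} vs = mapL (λ a → lincomb a vs) (allVecs d)

  spanList-unique : {n d : ℕ} (vs : Vec (Vec C n) d) → LinIndep vs → Unique (spanList vs)
  spanList-unique {d = d} vs li = Unique.map⁺ (lincomb-injective vs li) (allVecs-unique d)

  length-spanList : {n d : ℕ} (vs : Vec (Vec C n) d) → length (spanList vs) ≡ size ^ℕ d
  length-spanList {d = d} vs = trans (LP.length-map _ (allVecs d)) (length-allVecs d)

  LinIndep⇒≤n : {n d : ℕ} (vs : Vec (Vec C n) d) → LinIndep vs → d ≤ n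
  LinIndep⇒≤n {n} {d} vs li with d NP.≤? n
  ... | yes le = le
  ... | no nle = ⊥-elim (NP.<⇒≱ (NP.^-monoʳ-< size 2≤size (NP.≰⇒> nle)) le')
    where
    -- the span of vs consists of size ^ d distinct vectors of C^n
    le' : size ^ℕ d ≤ size ^ℕ n
    le' = subst₂ _≤_ (length-spanList vs) (length-allVecs n)
            (Unique-⊆⇒length≤ (spanList-unique vs li) (λ {z} _ → allVecs-∈ z))

  count-span : {n d : ℕ} (vs : Vec (Vec C n) d) → LinIndep vs → (P : Vec C n → Bool) →
               (∀ w → P w ≡ true → ∃ λ a → lincomb a vs ≡ w) → (∀ a → P (lincomb a vs) ≡ true) →
               length (filterᵇ P (allVecs n)) ≡ size ^ℕ d
  count-span {n} {d} vs li P f g =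
    trans (Unique-⊆⊇⇒length≡ (filterᵇ-unique P (allVecs-unique n)) (spanList-unique vs li) to from) (length-spanList vs)
    where
    to : ∀ {z} → z ∈ filterᵇ P (allVecs n) → z ∈ spanList vs
    to {z} z∈ = let (a , e) = f z (proj₂ (filterᵇ-∈⁻ P {allVecs n} z∈)) in subst (_∈ spanList vs) e (∈-map⁺ _ (allVecs-∈ a))
    from : ∀ {z} → z ∈ spanList vs → z ∈ filterᵇ P (allVecs n)
    from {z} z∈ = let (a , _ , e) = ∈-map⁻ _ z∈ in filterᵇ-∈⁺ P (allVecs-∈ z) (subst (λ u → P u ≡ true) (sym e) (g a))

  module _ {n : ℕ} (X : Vec C n → Bool) where
    private
      L : List ℕ
      L = filterᵇ (hasIndepFamily X) (upTo (suc n))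

    0∈L : 0 ∈ L
    0∈L = filterᵇ-∈⁺ (hasIndepFamily X) (∈-upTo⁺ (s≤s z≤n)) (hasIndep⁺ X [] (λ a _ → Vec₀-≡[] a) refl)

    dim-basis : ∃ λ (vs : Vec (Vec C n) (dim X)) → LinIndep vs × all X (toList vs) ≡ true
    dim-basis = hasIndep⁻ X (proj₂ (filterᵇ-∈⁻ (hasIndepFamily X) {upTo (suc n)} (foldr-⊔-∈ L 0∈L)))

    LinIndep⇒≤dim : {d : ℕ} (vs : Vec (Vec C n) d) → LinIndep vs → all X (toList vs) ≡ true → d ≤ dim X
    LinIndep⇒≤dim vs li h = foldr-⊔-upper L (filterᵇ-∈⁺ (hasIndepFamily X) (∈-upTo⁺ (s≤s (LinIndep⇒≤n vs li))) (hasIndep⁺ X vs li h))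

    dim-≤n : dim X ≤ n
    dim-≤n = foldr-⊔-lub L n (λ {x} x∈ → NP.≤-pred (∈-upTo⁻ (proj₁ (filterᵇ-∈⁻ (hasIndepFamily X) {upTo (suc n)} x∈))))

  LinIndep-∷ : {n d : ℕ} (vs : Vec (Vec C n) d) → LinIndep vs → (w : Vec C n) → inSpan vs w ≡ false → LinIndep (w ∷ vs)
  LinIndep-∷ vs li w nsp (a ∷ as) e with a ≟ 0#
  ... | yes a0 = cong₂ _∷_ a0 (li as (begin
          lincomb as vs ≡⟨ sym (⊕-identityˡ _) ⟩
          zeroV ⊕ lincomb as vs ≡⟨ cong (_⊕ lincomb as vs) (sym (trans (cong (_⊙ w) a0) (0⊙ w))) ⟩
          a ⊙ w ⊕ lincomb as vs ≡⟨ e ⟩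
          zeroV ∎))
  ... | no a≢0 = ⊥-elim (true≢false (subst (λ u → inSpan vs u ≡ true) (sym weq) (inSpan⁺ vs ((ia * (- 1#)) ⊙ as))) nsp)
    where
    ia : C
    ia = inv a a≢0
    weq : w ≡ lincomb ((ia * (- 1#)) ⊙ as) vs
    weq = begin
      w ≡⟨ sym (1⊙ w) ⟩
      1# ⊙ w ≡⟨ cong (_⊙ w) (sym (inv-l a a≢0)) ⟩
      (ia * a) ⊙ w ≡⟨ sym (⊙-⊙ ia a w) ⟩
      ia ⊙ (a ⊙ w) ≡⟨ cong (ia ⊙_) (u⊕v≡0⇒u≡-1⊙v _ _ e) ⟩
      ia ⊙ ((- 1#) ⊙ lincomb as vs) ≡⟨ ⊙-⊙ ia (- 1#) _ ⟩
      (ia * (- 1#)) ⊙ lincomb as vs ≡⟨ sym (lincomb-⊙ _ as vs) ⟩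
      lincomb ((ia * (- 1#)) ⊙ as) vs ∎

  dim-basis-spans : {n : ℕ} (X : Vec C n → Bool) (vs : Vec (Vec C n) (dim X)) → LinIndep vs → all X (toList vs) ≡ true →
               ∀ w → X w ≡ true → ∃ λ a → lincomb a vs ≡ w
  dim-basis-spans X vs li h w hw with inSpan vs w in eq
  ... | true = inSpan⁻ vs eq
  ... | false = ⊥-elim (NP.<-irrefl refl (LinIndep⇒≤dim X (w ∷ vs) (LinIndep-∷ vs li w eq) (∧-intro hw h)))

  LinIndep-n-spans : {n d : ℕ} (b : Vec (Vec C n) d) → LinIndep b → d ≡ n → ∀ z → ∃ λ a → lincomb a b ≡ z
  LinIndep-n-spans b li refl z with inSpan b z in eq
  ... | true = inSpan⁻ b eq
  ... | false = ⊥-elim (NP.<-irrefl refl (LinIndep⇒≤n (z ∷ b) (LinIndep-∷ b li z eq)))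

  inSpan-coefficients : {n m d : ℕ} (vs : Vec (Vec C n) m) (b : Vec (Vec C n) d) → all (inSpan vs) (toList b) ≡ true →
             ∃ λ (A : Vec (Vec C m) d) → mapV (λ a → lincomb a vs) A ≡ b
  inSpan-coefficients vs [] h = [] , refl
  inSpan-coefficients vs (v ∷ b) h =
    let (a , ea) = inSpan⁻ vs (proj₁ (∧-elim h))
        (A , eA) = inSpan-coefficients vs b (proj₂ (∧-elim {inSpan vs v} h))
    in (a ∷ A) , cong₂ _∷_ ea eA

  fullDim⇒perp≡0 : {n m : ℕ} (vs : Vec (Vec C n) m) → dim (inSpan vs) ≡ n →
               ∀ x → (∀ w → inSpan vs w ≡ true → dot w x ≡ 0#) → x ≡ zeroV
  fullDim⇒perp≡0 vs eqd x h = dot-nondegenerate x λ y →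
    let (b , li , hb) = dim-basis (inSpan vs)
        (a , ea) = LinIndep-n-spans b li eqd y
        (A , eA) = inSpan-coefficients vs b hb
    in h y (subst (λ u → inSpan vs u ≡ true)
             (trans (sym (lincomb-∘ a A vs)) (trans (cong (lincomb a) eA) ea)) (inSpan⁺ vs (lincomb a A)))

  perp≡0⇒fullDim : {n m : ℕ} (vs : Vec (Vec C n) m) →
               (∀ x → (∀ w → inSpan vs w ≡ true → dot w x ≡ 0#) → x ≡ zeroV) → dim (inSpan vs) ≡ n
  -- If dim < n, the dim × n matrix of a basis of the span has a nonzero vector a in its kernel, and a ⊥ span.
  perp≡0⇒fullDim {n} vs h with n NP.≤? dim (inSpan vs)
  ... | yes le = NP.≤-antisym (dim-≤n (inSpan vs)) le
  ... | no nle with dim-basis (inSpan vs)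
  ...   | b , li , hb with isIndep (transpose b) in eq
  ...     | true = ⊥-elim (nle (LinIndep⇒≤n (transpose b) (isIndep⁻ _ eq)))
  ...     | false =
    let (a , ea , a≢0) = isIndep-false (transpose b) eq
        mz : mapV (dot a) b ≡ zeroV
        mz = trans (sym (lincomb-transpose a b)) ea
    in ⊥-elim (a≢0 (h a (λ w hw →
         let (c , ec) = dim-basis-spans (inSpan vs) b li hb w hw
         in begin
           dot w a ≡⟨ cong (λ u → dot u a) (sym ec) ⟩
           dot (lincomb c b) a ≡⟨ dot-lincombˡ c b a ⟩
           dot c (mapV (λ v → dot v a) b) ≡⟨ cong (dot c) (VP.map-cong (λ v → dot-comm v a) b) ⟩
           dot c (mapV (dot a) b) ≡⟨ cong (dot c) mz ⟩
           dot c zeroV ≡⟨ dot-zeroʳ c ⟩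
           0# ∎)))

  isOne : Maybe C → Bool
  isOne (just a) = ⌊ a ≟ 1# ⌋
  isOne nothing = false

  isNormalized-firstNonzero : {n : ℕ} (v : Vec C n) → isNormalized v ≡ isOne (firstNonzero v)
  isNormalized-firstNonzero v with firstNonzero v
  ... | just a = refl
  ... | nothing = refl

  points-∈⁻ : {n : ℕ} {p : Vec C n} → p ∈ points n → isNormalized p ≡ true
  points-∈⁻ {n} p∈ = proj₂ (filterᵇ-∈⁻ isNormalized {allVecs n} p∈)

  points-∈⁺ : {n : ℕ} {p : Vec C n} → isNormalized p ≡ true → p ∈ points n
  points-∈⁺ {n} {p} h = filterᵇ-∈⁺ isNormalized (allVecs-∈ p) h

  firstNonzero-zeroV : (n : ℕ) → firstNonzero (zeroV {n}) ≡ nothing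
  firstNonzero-zeroV zero = refl
  firstNonzero-zeroV (suc n) rewrite isZero-≡ {0#} refl = firstNonzero-zeroV n

  firstNonzero-0∷ : {n : ℕ} (v : Vec C n) → firstNonzero (0# ∷ v) ≡ firstNonzero v
  firstNonzero-0∷ v rewrite isZero-≡ {0#} refl = refl

  points-≢0 : {n : ℕ} {p : Vec C n} → p ∈ points n → p ≢ zeroV
  points-≢0 {n} p∈ refl = true≢false (points-∈⁻ p∈) (trans (isNormalized-firstNonzero (zeroV {n})) (cong isOne (firstNonzero-zeroV n)))

  firstNonzero-≢0 : {n : ℕ} (x : Vec C n) → x ≢ zeroV → ∃ λ a → firstNonzero x ≡ just a × a ≢ 0#
  firstNonzero-≢0 [] ne = ⊥-elim (ne refl)
  firstNonzero-≢0 (x ∷ xs) ne with isZero x in eq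
  ... | false = x , refl , isZero-false eq
  ... | true = firstNonzero-≢0 xs (λ e → ne (cong₂ _∷_ (isZero-true eq) e))

  firstNonzero-⊙ : {n : ℕ} (s : C) → s ≢ 0# → (x : Vec C n) → firstNonzero (s ⊙ x) ≡ Data.Maybe.map (s *_) (firstNonzero x)
  firstNonzero-⊙ s s≢0 [] = refl
  firstNonzero-⊙ s s≢0 (x ∷ xs) with isZero x in eq
  ... | true rewrite isZero-≡ {s * x} (trans (cong (s *_) (isZero-true eq)) (zeroʳ s)) = firstNonzero-⊙ s s≢0 xs
  ... | false rewrite isZero-≢ {s * x} (λ e → isZero-false eq (x*y≡0⇒y≡0 s≢0 e)) = refl

  point-multiple : {n : ℕ} (x : Vec C n) → x ≢ zeroV → ∃ λ a → a ≢ 0# × ∃ λ p → p ∈ points n × x ≡ a ⊙ p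
  point-multiple x ne =
    let (a , ef , a≢0) = firstNonzero-≢0 x ne
        ia : C
        ia = inv a a≢0
        ia≢0 : ia ≢ 0#
        ia≢0 = λ e → 1≢0 (trans (sym (inv-l a a≢0)) (trans (cong (_* a) e) (zeroˡ a)))
        fp : firstNonzero (ia ⊙ x) ≡ just 1#
        fp = trans (firstNonzero-⊙ ia ia≢0 x) (trans (cong (Data.Maybe.map (ia *_)) ef) (cong just (inv-l a a≢0)))
    in a , a≢0 , ia ⊙ x , points-∈⁺ (trans (isNormalized-firstNonzero (ia ⊙ x)) (trans (cong isOne fp) (≡⇒⌊≟⌋-true _≟_ refl))) ,
       sym (trans (⊙-⊙ a ia x) (trans (cong (_⊙ x) (inv-r a a≢0)) (1⊙ x)))

  standardBasis : (n : ℕ) → Vec (Vec C n) n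
  standardBasis zero = []
  standardBasis (suc n) = (1# ∷ zeroV) ∷ mapV (0# ∷_) (standardBasis n)

  standardBasis⊆points : (n : ℕ) {e : Vec C n} → e ∈ toList (standardBasis n) → e ∈ points n
  standardBasis⊆points (suc n) (here refl) = points-∈⁺ (trans (isNormalized-firstNonzero (1# ∷ zeroV {n})) (leadingOne (isZero-≢ 1≢0)))
    where
    leadingOne : isZero 1# ≡ false → isOne (firstNonzero (1# ∷ zeroV {n})) ≡ true
    leadingOne eq rewrite eq = ≡⇒⌊≟⌋-true _≟_ refl
  standardBasis⊆points (suc n) {e} (there e∈) with ∈-map⁻ (0# ∷_) (subst (e ∈_) (VP.toList-map (0# ∷_) (standardBasis n)) e∈)
  ... | e' , e'∈ , refl = points-∈⁺ (begin
    isNormalized (0# ∷ e')     ≡⟨ isNormalized-firstNonzero (0# ∷ e') ⟩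
    isOne (firstNonzero (0# ∷ e')) ≡⟨ cong isOne (firstNonzero-0∷ e') ⟩
    isOne (firstNonzero e')    ≡⟨ sym (isNormalized-firstNonzero e') ⟩
    isNormalized e'            ≡⟨ points-∈⁻ (standardBasis⊆points n e'∈) ⟩
    true                       ∎)

  standardBasis-dot : {n : ℕ} (z : Vec C n) → mapV (λ e → dot e z) (standardBasis n) ≡ z
  standardBasis-dot [] = refl
  standardBasis-dot {suc n} (z ∷ zs) = cong₂ _∷_ (trans (cong₂ _+_ (*-identityˡ z) (dot-zeroˡ zs)) (+-identityʳ z))
    (trans (sym (VP.map-∘ (λ e → dot e (z ∷ zs)) (0# ∷_) (standardBasis n)))
      (trans (VP.map-cong (λ e → trans (cong (λ w → w + dot e zs) (zeroˡ z)) (+-identityˡ _)) (standardBasis n)) (standardBasis-dot zs)))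

  map-zero : {A : Set} {d : ℕ} (f : A → C) (v : Vec A d) → (∀ {x} → x ∈ toList v → f x ≡ 0#) → mapV f v ≡ zeroV
  map-zero f [] h = refl
  map-zero f (x ∷ v) h = cong₂ _∷_ (h (here refl)) (map-zero f v (λ x∈ → h (there x∈)))

  map-zero⁻ : {A : Set} {d : ℕ} (f : A → C) (v : Vec A d) → mapV f v ≡ zeroV → ∀ {x} → x ∈ toList v → f x ≡ 0#
  map-zero⁻ f (y ∷ v) e (here refl) = proj₁ (VP.∷-injective e)
  map-zero⁻ f (y ∷ v) e (there x∈) = map-zero⁻ f v (proj₂ (VP.∷-injective e)) x∈

  standardBasis-nondeg : {n : ℕ} (c : Vec C n) → (∀ {e} → e ∈ toList (standardBasis n) → dot e c ≡ 0#) → c ≡ zeroV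
  standardBasis-nondeg c h = trans (sym (standardBasis-dot c)) (map-zero (λ e → dot e c) (standardBasis _) h)

  x+x≡x⇒x≡0 : (x : C) → x + x ≡ x → x ≡ 0#
  x+x≡x⇒x≡0 x = +-identityˡ-unique x x

  map-⊕ : {A : Set} {n : ℕ} (f g : A → C) (c : Vec A n) → mapV f c ⊕ mapV g c ≡ mapV (λ y → f y + g y) c
  map-⊕ f g [] = refl
  map-⊕ f g (y ∷ c) = cong (_ ∷_) (map-⊕ f g c)

  ⊙-map : {A : Set} {n : ℕ} (a : C) (f : A → C) (c : Vec A n) → a ⊙ mapV f c ≡ mapV (λ y → a * f y) c
  ⊙-map a f [] = refl
  ⊙-map a f (y ∷ c) = cong (_ ∷_) (⊙-map a f c)

  lincomb-pointwise : {A X : Set} {n d : ℕ} (a : Vec C d) (U : Vec X d) (g : X → A → C) (c : Vec A n) →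
    lincomb a (mapV (λ u → mapV (g u) c) U) ≡ mapV (λ y → dot a (mapV (λ u → g u y) U)) c
  lincomb-pointwise [] [] g c = sym (map-zero _ c (λ _ → refl))
  lincomb-pointwise (a ∷ as) (u ∷ U) g c = begin
    a ⊙ mapV (g u) c ⊕ lincomb as (mapV (λ u → mapV (g u) c) U) ≡⟨ cong₂ _⊕_ (⊙-map a (g u) c) (lincomb-pointwise as U g c) ⟩
    mapV (λ y → a * g u y) c ⊕ mapV (λ y → dot as (mapV (λ u → g u y) U)) c ≡⟨ map-⊕ _ _ c ⟩
    mapV (λ y → dot (a ∷ as) (mapV (λ u → g u y) (u ∷ U))) c ∎

  span-coefficients : {n k d : ℕ} (G : Vec (Vec C n) k) (b : Vec (Vec C n) d) → (∀ {v} → v ∈ toList b → ∃ λ a → lincomb a G ≡ v) →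
             ∃ λ (A : Vec (Vec C k) d) → mapV (λ a → lincomb a G) A ≡ b
  span-coefficients G [] h = [] , refl
  span-coefficients G (v ∷ b) h =
    let (a , ea) = h (here refl)
        (A , eA) = span-coefficients G b (λ v∈ → h (there v∈))
    in (a ∷ A) , cong₂ _∷_ ea eA

  lincomb-⊥ : {n d : ℕ} (b : Vec (Vec C n) d) (x : Vec C n) → (∀ {v} → v ∈ toList b → dot v x ≡ 0#) →
              ∀ a → dot (lincomb a b) x ≡ 0#
  lincomb-⊥ b x b⊥x a = trans (dot-lincombˡ a b x) (trans (cong (dot a) (map-zero _ b b⊥x)) (dot-zeroʳ a))

  LinIndep-⊆span⇒≤ : {n k d : ℕ} (G : Vec (Vec C n) k) (b : Vec (Vec C n) d) → LinIndep b →
                     (∀ {v} → v ∈ toList b → ∃ λ a → lincomb a G ≡ v) → d ≤ k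
  LinIndep-⊆span⇒≤ {k = k} {d} G b li b⊆G = LinIndep⇒≤n A liA
    where
    A : Vec (Vec C k) d
    A = proj₁ (span-coefficients G b b⊆G)
    liA : LinIndep A
    liA l el = li l (begin
      lincomb l b                             ≡⟨ cong (lincomb l) (sym (proj₂ (span-coefficients G b b⊆G))) ⟩
      lincomb l (mapV (λ a → lincomb a G) A)  ≡⟨ lincomb-∘ l A G ⟩
      lincomb (lincomb l A) G                 ≡⟨ cong (λ z → lincomb z G) el ⟩
      lincomb zeroV G                         ≡⟨ lincomb-0 G ⟩
      zeroV                                   ∎)

  LinIndep-⊥-injective⇒≤ : {n d : ℕ} {Y : Set} (b : Vec (Vec C n) d) (ps : List Y) (t : Y → Vec C n) → LinIndep b →
                           (∀ a → (∀ {p} → p ∈ ps → dot (lincomb a b) (t p) ≡ 0#) → lincomb a b ≡ zeroV) →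
                           d ≤ length ps
  LinIndep-⊥-injective⇒≤ {d = d} b ps t li ⊥⇒0 = LinIndep⇒≤n Fm liF
    where
    -- v ↦ (v · t p)ₚ is injective on the span of b, so it keeps b independent in C^|ps|.
    Fm : Vec (Vec C (length ps)) d
    Fm = mapV (λ u → mapV (λ p → dot u (t p)) (fromList ps)) b
    liF : LinIndep Fm
    liF l el = li l (⊥⇒0 l λ {p} p∈ → begin
      dot (lincomb l b) (t p)             ≡⟨ dot-lincombˡ l b (t p) ⟩
      dot l (mapV (λ u → dot u (t p)) b)  ≡⟨ map-zero⁻ _ (fromList ps) Fm-l≡0 (subst (p ∈_) (sym (VP.toList∘fromList ps)) p∈) ⟩
      0#                                  ∎)
      where
      Fm-l≡0 : mapV (λ p → dot l (mapV (λ u → dot u (t p)) b)) (fromList ps) ≡ zeroV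
      Fm-l≡0 = trans (sym (lincomb-pointwise l b (λ u p → dot u (t p)) (fromList ps))) el

module Embedding (K L : FiniteField)
           (ι : FiniteField.Carrier K → FiniteField.Carrier L)
           (ι-+ : ∀ x y → ι (FiniteField._+_ K x y) ≡ FiniteField._+_ L (ι x) (ι y))
           (ι-* : ∀ x y → ι (FiniteField._*_ K x y) ≡ FiniteField._*_ L (ι x) (ι y))
           (ι-1 : ι (FiniteField.1# K) ≡ FiniteField.1# L) where
  module K = VectorSpace K
  module L = VectorSpace L
  open K using () renaming (_+_ to _+ₖ_; _*_ to _*ₖ_; _⊕_ to _⊕ₖ_; _⊙_ to _⊙ₖ_)
  open L using (_+_; _*_; _⊕_; _⊙_)
  open IsCommutativeRing (FiniteField.isCommutativeRing L) using (zeroˡ)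
  module KR = IsCommutativeRing (FiniteField.isCommutativeRing K)
  open ≡-Reasoning
  0ₖ 1ₖ : K.C
  0ₖ = FiniteField.0# K
  1ₖ = FiniteField.1# K
  0ₗ 1ₗ : L.C
  0ₗ = FiniteField.0# L
  1ₗ = FiniteField.1# L

  ι-0 : ι 0ₖ ≡ 0ₗ
  ι-0 = L.x+x≡x⇒x≡0 (ι 0ₖ) (trans (sym (ι-+ 0ₖ 0ₖ)) (cong ι (KR.+-identityˡ 0ₖ)))

  ι-≢0 : {a : K.C} → a ≢ 0ₖ → ι a ≢ 0ₗ
  ι-≢0 {a} a≢0 ιa≡0 = L.1≢0 (begin
    1ₗ                     ≡⟨ sym ι-1 ⟩
    ι 1ₖ                   ≡⟨ cong ι (sym (K.inv-r a a≢0)) ⟩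
    ι (a *ₖ K.inv a a≢0)    ≡⟨ ι-* a _ ⟩
    ι a * ι (K.inv a a≢0)   ≡⟨ cong (_* ι (K.inv a a≢0)) ιa≡0 ⟩
    0ₗ * ι (K.inv a a≢0)    ≡⟨ zeroˡ _ ⟩
    0ₗ                     ∎)

  ιV : {n : ℕ} → Vec K.C n → Vec L.C n
  ιV = mapV ι

  ιV-zero : {n : ℕ} → ιV (K.zeroV {n}) ≡ L.zeroV
  ιV-zero {zero} = refl
  ιV-zero {suc n} = cong₂ _∷_ ι-0 ιV-zero

  ιV-⊕ : {n : ℕ} (u v : Vec K.C n) → ιV (u ⊕ₖ v) ≡ ιV u ⊕ ιV v
  ιV-⊕ [] [] = refl
  ιV-⊕ (x ∷ u) (y ∷ v) = cong₂ _∷_ (ι-+ x y) (ιV-⊕ u v)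

  ιV-⊙ : {n : ℕ} (a : K.C) (v : Vec K.C n) → ιV (a ⊙ₖ v) ≡ ι a ⊙ ιV v
  ιV-⊙ a [] = refl
  ιV-⊙ a (x ∷ v) = cong₂ _∷_ (ι-* a x) (ιV-⊙ a v)

  ιV-lincomb : {n d : ℕ} (a : Vec K.C d) (vs : Vec (Vec K.C n) d) → ιV (K.lincomb a vs) ≡ L.lincomb (ιV a) (mapV ιV vs)
  ιV-lincomb [] [] = ιV-zero
  ιV-lincomb (a ∷ as) (v ∷ vs) = trans (ιV-⊕ _ _) (cong₂ _⊕_ (ιV-⊙ a v) (ιV-lincomb as vs))

  dot-ι : {n : ℕ} (u v : Vec K.C n) → L.dot (ιV u) (ιV v) ≡ ι (K.dot u v)
  dot-ι [] [] = sym ι-0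
  dot-ι (x ∷ u) (y ∷ v) = trans (cong₂ _+_ (sym (ι-* x y)) (dot-ι u v)) (sym (ι-+ _ _))

  ιV-standardBasis : (n : ℕ) → mapV ιV (K.standardBasis n) ≡ L.standardBasis n
  ιV-standardBasis zero = refl
  ιV-standardBasis (suc n) = cong₂ _∷_ (cong₂ _∷_ ι-1 ιV-zero)
    (trans (sym (VP.map-∘ ιV (0ₖ ∷_) (K.standardBasis n))) (trans (VP.map-cong (λ v → cong (_∷ ιV v) ι-0) (K.standardBasis n))
      (trans (VP.map-∘ (0ₗ ∷_) ιV (K.standardBasis n)) (cong (mapV (0ₗ ∷_)) (ιV-standardBasis n)))))

  points-nondeg : {n : ℕ} (c : Vec L.C n) → (∀ {p} → p ∈ K.points n → L.dot c (ιV p) ≡ 0ₗ) → c ≡ L.zeroV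
  points-nondeg {n} c h = L.standardBasis-nondeg c (λ {e} e∈ → go e∈)
    where
    go : ∀ {e} → e ∈ toList (L.standardBasis n) → L.dot e c ≡ 0ₗ
    go {e} e∈ with ∈-map⁻ ιV (subst (e ∈_) (trans (cong toList (sym (ιV-standardBasis n))) (VP.toList-map ιV (K.standardBasis n))) e∈)
    ... | u , u∈ , refl = trans (L.dot-comm _ c) (h (K.standardBasis⊆points n u∈))

  dot-lincomb≡0⇒dot≡0 : {n d : ℕ} (c : Vec L.C n) (vs : Vec (Vec K.C n) d) → (∀ a → L.dot c (ιV (K.lincomb a vs)) ≡ 0ₗ) →
               ∀ {p} → p ∈ toList vs → L.dot c (ιV p) ≡ 0ₗ
  dot-lincomb≡0⇒dot≡0 {n} {d} c vs h = L.map-zero⁻ (λ v → L.dot c (ιV v)) vs z0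
    where
    z0 : mapV (λ v → L.dot c (ιV v)) vs ≡ L.zeroV
    z0 = L.standardBasis-nondeg _ λ {e} e∈ →
      let (u , u∈ , eu) = ∈-map⁻ ιV (subst (e ∈_) (trans (cong toList (sym (ιV-standardBasis d))) (VP.toList-map ιV (K.standardBasis d))) e∈)
      in begin
        L.dot e (mapV (λ v → L.dot c (ιV v)) vs) ≡⟨ cong (λ z → L.dot z _) eu ⟩
        L.dot (ιV u) (mapV (λ v → L.dot c (ιV v)) vs) ≡⟨ cong (L.dot (ιV u)) (VP.map-∘ (L.dot c) ιV vs) ⟩
        L.dot (ιV u) (mapV (L.dot c) (mapV ιV vs)) ≡⟨ sym (L.dot-lincombʳ c (ιV u) (mapV ιV vs)) ⟩
        L.dot c (L.lincomb (ιV u) (mapV ιV vs)) ≡⟨ cong (L.dot c) (sym (ιV-lincomb u vs)) ⟩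
        L.dot c (ιV (K.lincomb u vs)) ≡⟨ h u ⟩
        0ₗ ∎

  dot≡0⇒dot-lincomb≡0 : {n d : ℕ} (c : Vec L.C n) (vs : Vec (Vec K.C n) d) → (∀ {p} → p ∈ toList vs → L.dot c (ιV p) ≡ 0ₗ) →
               ∀ a → L.dot c (ιV (K.lincomb a vs)) ≡ 0ₗ
  dot≡0⇒dot-lincomb≡0 c vs h a = begin
    L.dot c (ιV (K.lincomb a vs)) ≡⟨ cong (L.dot c) (ιV-lincomb a vs) ⟩
    L.dot c (L.lincomb (ιV a) (mapV ιV vs)) ≡⟨ L.dot-lincombʳ c (ιV a) (mapV ιV vs) ⟩
    L.dot (ιV a) (mapV (L.dot c) (mapV ιV vs)) ≡⟨ cong (L.dot (ιV a)) (sym (VP.map-∘ (L.dot c) ιV vs)) ⟩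
    L.dot (ιV a) (mapV (λ v → L.dot c (ιV v)) vs) ≡⟨ cong (L.dot (ιV a)) (L.map-zero _ vs h) ⟩
    L.dot (ιV a) L.zeroV ≡⟨ L.dot-zeroʳ (ιV a) ⟩
    0ₗ ∎

module RowSupport (K L : FiniteField)
           (ι : FiniteField.Carrier K → FiniteField.Carrier L)
           (ι-+ : ∀ x y → ι (FiniteField._+_ K x y) ≡ FiniteField._+_ L (ι x) (ι y))
           (ι-* : ∀ x y → ι (FiniteField._*_ K x y) ≡ FiniteField._*_ L (ι x) (ι y))
           (ι-1 : ι (FiniteField.1# K) ≡ FiniteField.1# L)
           (e : ℕ) (φ : FiniteField.Carrier L → Vec (FiniteField.Carrier K) e)
           (φ-+ : ∀ x y → φ (FiniteField._+_ L x y) ≡ VectorSpace._⊕_ K (φ x) (φ y))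
           (φ-ι* : ∀ a y → φ (FiniteField._*_ L (ι a) y) ≡ VectorSpace._⊙_ K a (φ y))
           (φ≡0⇒≡0 : ∀ y → φ y ≡ VectorSpace.zeroV K → y ≡ FiniteField.0# L) where
  -- φ is the coordinate map of a K-basis of L; Rsupp c below is the K-row space of the e × n matrix of
  -- coordinates of c, whose elements are the rows π b c = bᵀ · (coordinates of c).
  open Embedding K L ι ι-+ ι-* ι-1 public
  open K using () renaming (_+_ to _+ₖ_; _*_ to _*ₖ_; _⊕_ to _⊕ₖ_; _⊙_ to _⊙ₖ_)
  open L using (_+_; _*_; _⊕_; _⊙_)
  open IsCommutativeRing (FiniteField.isCommutativeRing L) using (*-comm; zeroˡ)
  open ≡-Reasoning

  φ-0 : φ 0ₗ ≡ K.zeroV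
  φ-0 = begin
    φ 0ₗ ≡⟨ cong φ (sym (trans (cong (_* 0ₗ) ι-0) (zeroˡ 0ₗ))) ⟩
    φ (ι 0ₖ * 0ₗ) ≡⟨ φ-ι* 0ₖ 0ₗ ⟩
    0ₖ ⊙ₖ φ 0ₗ ≡⟨ K.0⊙ _ ⟩
    K.zeroV ∎

  π : {n : ℕ} → Vec K.C e → Vec L.C n → Vec K.C n
  π b c = mapV (λ y → K.dot b (φ y)) c

  dot-map : {n : ℕ} (b : Vec K.C e) (c : Vec L.C n) (x : Vec K.C n) → K.dot (π b c) x ≡ K.dot b (φ (L.dot c (ιV x)))
  dot-map b [] [] = sym (trans (cong (K.dot b) φ-0) (K.dot-zeroʳ b))
  dot-map b (c ∷ cs) (x ∷ xs) = begin
    K.dot b (φ c) *ₖ x +ₖ K.dot (π b cs) xs ≡⟨ cong₂ _+ₖ_ (KR.*-comm _ x) (dot-map b cs xs) ⟩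
    x *ₖ K.dot b (φ c) +ₖ K.dot b (φ (L.dot cs (ιV xs))) ≡⟨ cong (_+ₖ K.dot b (φ (L.dot cs (ιV xs)))) (sym (K.dot-⊙ʳ x b (φ c))) ⟩
    K.dot b (x ⊙ₖ φ c) +ₖ K.dot b (φ (L.dot cs (ιV xs))) ≡⟨ sym (K.dot-⊕ʳ b _ _) ⟩
    K.dot b (x ⊙ₖ φ c ⊕ₖ φ (L.dot cs (ιV xs)))
      ≡⟨ cong (λ z → K.dot b (z ⊕ₖ φ (L.dot cs (ιV xs)))) (sym (trans (cong φ (*-comm c (ι x))) (φ-ι* x c))) ⟩
    K.dot b (φ (c * ι x) ⊕ₖ φ (L.dot cs (ιV xs))) ≡⟨ cong (K.dot b) (sym (φ-+ _ _)) ⟩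
    K.dot b (φ (c * ι x + L.dot cs (ιV xs))) ∎

  Rsupp : {n : ℕ} → Vec L.C n → Vec K.C n → Bool
  Rsupp c = K.inSpan (transpose (mapV φ c))

  lincomb-Rsupp : {n : ℕ} (b : Vec K.C e) (c : Vec L.C n) → K.lincomb b (transpose (mapV φ c)) ≡ π b c
  lincomb-Rsupp b c = trans (K.lincomb-transpose b (mapV φ c)) (sym (VP.map-∘ (K.dot b) φ c))

  Rsupp⁻ : {n : ℕ} (c : Vec L.C n) {w : Vec K.C n} → Rsupp c w ≡ true → ∃ λ b → π b c ≡ w
  Rsupp⁻ c h = let (b , eb) = K.inSpan⁻ _ h in b , trans (sym (lincomb-Rsupp b c)) eb

  Rsupp⁺ : {n : ℕ} (c : Vec L.C n) (b : Vec K.C e) → Rsupp c (π b c) ≡ true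
  Rsupp⁺ c b = subst (λ u → Rsupp c u ≡ true) (lincomb-Rsupp b c) (K.inSpan⁺ _ b)

  Rsupp-⊥⇒dot≡0 : {n : ℕ} (c : Vec L.C n) (x : Vec K.C n) → (∀ w → Rsupp c w ≡ true → K.dot w x ≡ 0ₖ) → L.dot c (ιV x) ≡ 0ₗ
  Rsupp-⊥⇒dot≡0 c x h = φ≡0⇒≡0 _ (K.dot-nondegenerate _ (λ b → trans (sym (dot-map b c x)) (h (π b c) (Rsupp⁺ c b))))

  dot≡0⇒Rsupp-⊥ : {n : ℕ} (c : Vec L.C n) (x : Vec K.C n) → L.dot c (ιV x) ≡ 0ₗ → ∀ w → Rsupp c w ≡ true → K.dot w x ≡ 0ₖ
  dot≡0⇒Rsupp-⊥ c x h w hw = let (b , eb) = Rsupp⁻ c hw in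
    trans (cong (λ u → K.dot u x) (sym eb)) (trans (dot-map b c x) (trans (cong (λ z → K.dot b (φ z)) h) (trans (cong (K.dot b) φ-0) (K.dot-zeroʳ b))))

  π-zero : {n : ℕ} (b : Vec K.C e) → π b (L.zeroV {n}) ≡ K.zeroV
  π-zero b = K.map-zero _ L.zeroV (λ {x} x∈ → trans (cong (λ z → K.dot b (φ z)) (zero-mem x∈)) (trans (cong (K.dot b) φ-0) (K.dot-zeroʳ b)))
    where
    zero-mem : ∀ {m} {x} → x ∈ toList (L.zeroV {m}) → x ≡ 0ₗ
    zero-mem {suc m} (here refl) = refl
    zero-mem {suc m} (there x∈) = zero-mem {m} x∈

  π-⊕ : {n : ℕ} (b : Vec K.C e) (u v : Vec L.C n) → π b (u ⊕ v) ≡ π b u ⊕ₖ π b v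
  π-⊕ b [] [] = refl
  π-⊕ b (x ∷ u) (y ∷ v) = cong₂ _∷_ (trans (cong (K.dot b) (φ-+ x y)) (K.dot-⊕ʳ b _ _)) (π-⊕ b u v)

  π-⊙ι : {n : ℕ} (b : Vec K.C e) (l : L.C) (v : Vec K.C n) → π b (l ⊙ ιV v) ≡ K.dot b (φ l) ⊙ₖ v
  π-⊙ι b l [] = refl
  π-⊙ι b l (x ∷ v) = cong₂ _∷_ head (π-⊙ι b l v)
    where
    head : K.dot b (φ (l * ι x)) ≡ K.dot b (φ l) *ₖ x
    head = begin
      K.dot b (φ (l * ι x))  ≡⟨ cong (λ z → K.dot b (φ z)) (*-comm l (ι x)) ⟩
      K.dot b (φ (ι x * l))  ≡⟨ cong (K.dot b) (φ-ι* x l) ⟩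
      K.dot b (x ⊙ₖ φ l)     ≡⟨ K.dot-⊙ʳ x b (φ l) ⟩
      x *ₖ K.dot b (φ l)     ≡⟨ KR.*-comm x _ ⟩
      K.dot b (φ l) *ₖ x     ∎

  π-lincomb : {n d : ℕ} (b : Vec K.C e) (l : Vec L.C d) (V : Vec (Vec K.C n) d) →
              π b (L.lincomb l (mapV ιV V)) ≡ K.lincomb (π b l) V
  π-lincomb b [] [] = π-zero b
  π-lincomb b (l ∷ ls) (v ∷ V) = trans (π-⊕ b _ _) (cong₂ _⊕ₖ_ (π-⊙ι b l v) (π-lincomb b ls V))

module FieldExtension (K L : FiniteField) (d : ℕ) (E : Extension K L d) where
  open Extension E
  module H = Embedding K L ι ι-+ ι-* ι-1
  open H.K using () renaming (_+_ to _+ₖ_; _*_ to _*ₖ_; _⊕_ to _⊕ₖ_; _⊙_ to _⊙ₖ_)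
  open H.L using (_+_; _*_; _⊕_; _⊙_)
  open ≡-Reasoning

  -- expand a is definitionally H.L.dot (H.ιV a) basis.
  expand-⊕ : ∀ a b → expand (a ⊕ₖ b) ≡ expand a + expand b
  expand-⊕ a b = trans (cong (λ z → H.L.dot z basis) (H.ιV-⊕ a b)) (H.L.dot-⊕ˡ (H.ιV a) (H.ιV b) basis)

  expand-⊙ : ∀ s a → expand (s ⊙ₖ a) ≡ ι s * expand a
  expand-⊙ s a = trans (cong (λ z → H.L.dot z basis) (H.ιV-⊙ s a)) (H.L.dot-⊙ˡ (ι s) (H.ιV a) basis)

  coord-+ : ∀ x y → coord (x + y) ≡ coord x ⊕ₖ coord y
  coord-+ x y = begin
    coord (x + y) ≡⟨ cong coord (sym (cong₂ _+_ (expand-coord x) (expand-coord y))) ⟩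
    coord (expand (coord x) + expand (coord y)) ≡⟨ cong coord (sym (expand-⊕ (coord x) (coord y))) ⟩
    coord (expand (coord x ⊕ₖ coord y)) ≡⟨ coord-expand _ ⟩
    coord x ⊕ₖ coord y ∎

  coord-ι* : ∀ a y → coord (ι a * y) ≡ a ⊙ₖ coord y
  coord-ι* a y = begin
    coord (ι a * y) ≡⟨ cong (λ z → coord (ι a * z)) (sym (expand-coord y)) ⟩
    coord (ι a * expand (coord y)) ≡⟨ cong coord (sym (expand-⊙ a (coord y))) ⟩
    coord (expand (a ⊙ₖ coord y)) ≡⟨ coord-expand _ ⟩
    a ⊙ₖ coord y ∎

  coord≡0⇒≡0 : ∀ y → coord y ≡ H.K.zeroV → y ≡ H.0ₗ
  coord≡0⇒≡0 y h = begin
    y ≡⟨ sym (expand-coord y) ⟩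
    expand (coord y) ≡⟨ cong expand h ⟩
    H.L.dot (H.ιV H.K.zeroV) basis ≡⟨ cong (λ z → H.L.dot z basis) H.ιV-zero ⟩
    H.L.dot H.L.zeroV basis ≡⟨ H.L.dot-zeroˡ basis ⟩
    H.0ₗ ∎

  open RowSupport K L ι ι-+ ι-* ι-1 d coord coord-+ coord-ι* coord≡0⇒≡0 public

  reconstruct : {n : ℕ} (c : Vec L.C n) → c ≡ L.lincomb basis (mapV (λ e → ιV (π e c)) (K.standardBasis d))
  reconstruct c = sym (begin
    L.lincomb basis (mapV (λ e → ιV (π e c)) (K.standardBasis d))
      ≡⟨ cong (L.lincomb basis) (VP.map-cong (λ e → sym (VP.map-∘ ι (λ y → K.dot e (coord y)) c)) (K.standardBasis d)) ⟩
    L.lincomb basis (mapV (λ u → mapV (λ y → ι (K.dot u (coord y))) c) (K.standardBasis d))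
      ≡⟨ L.lincomb-pointwise basis (K.standardBasis d) (λ u y → ι (K.dot u (coord y))) c ⟩
    mapV (λ y → L.dot basis (mapV (λ u → ι (K.dot u (coord y))) (K.standardBasis d))) c
      ≡⟨ VP.map-cong (λ y → cong (L.dot basis) (trans (VP.map-∘ ι (λ u → K.dot u (coord y)) (K.standardBasis d))
                                                     (cong ιV (K.standardBasis-dot (coord y))))) c ⟩
    mapV (λ y → L.dot basis (ιV (coord y))) c
      ≡⟨ VP.map-cong (λ y → trans (L.dot-comm basis _) (expand-coord y)) c ⟩
    mapV (λ y → y) c
      ≡⟨ VP.map-id c ⟩
    c ∎)

  size-ext : FiniteField.size L ≡ FiniteField.size K ^ℕ d
  size-ext = trans (Unique-⊆⊇⇒length≡ (FiniteField.elements-unique L) (Unique.map⁺ inj (K.allVecs-unique d)) to from)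
                   (trans (LP.length-map expand (K.allVecs d)) (K.length-allVecs d))
    where
    inj : ∀ {a b} → expand a ≡ expand b → a ≡ b
    inj {a} {b} e = trans (sym (coord-expand a)) (trans (cong coord e) (coord-expand b))
    to : ∀ {z} → z ∈ FiniteField.elements L → z ∈ mapL expand (K.allVecs d)
    to {z} _ = subst (_∈ mapL expand (K.allVecs d)) (expand-coord z) (∈-map⁺ expand (K.allVecs-∈ (coord z)))
    from : ∀ {z} → z ∈ mapL expand (K.allVecs d) → z ∈ FiniteField.elements L
    from {z} _ = FiniteField.elements-complete L z

  ιV-LinIndep : {n dd : ℕ} (b : Vec (Vec K.C n) dd) → K.LinIndep b → L.LinIndep (mapV ιV b)
  ιV-LinIndep b li l el = π-zero⇒zero l (λ e → li (π e l) (trans (sym (π-lincomb e l b)) (trans (cong (π e) el) (π-zero e))))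
    where
    π-zero⇒zero : ∀ {m} (l : Vec L.C m) → (∀ e → π e l ≡ K.zeroV) → l ≡ L.zeroV
    π-zero⇒zero []      h = refl
    π-zero⇒zero (y ∷ l) h =
      cong₂ _∷_ (coord≡0⇒≡0 y (K.dot-nondegenerate (coord y) (λ e → proj₁ (VP.∷-injective (h e)))))
                (π-zero⇒zero l (λ e → proj₂ (VP.∷-injective (h e))))

  module _ {n k dd : ℕ} {Y : Set} (G : Vec (Vec K.C n) k) (ps : List Y) (t : Y → Vec K.C n)
           (b : Vec (Vec K.C n) dd) where
    private
      ιb : Vec (Vec L.C n) dd
      ιb = mapV ιV b
      ιG : Vec (Vec L.C n) k
      ιG = mapV ιV G

    SpanPerp-ιV⊆span : (∀ w → K.SpanPerp G ps t w → ∃ λ a → K.lincomb a b ≡ w) →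
                       ∀ w → L.SpanPerp ιG ps (ιV ∘ t) w → ∃ λ a → L.lincomb a ιb ≡ w
    SpanPerp-ιV⊆span V⊆b w ((l , el) , w⊥) =
      L.lincomb basis (mapV (λ e → ιV (ν e)) (K.standardBasis d)) , sym (begin
        w                                                                 ≡⟨ reconstruct w ⟩
        L.lincomb basis (mapV (λ e → ιV (π e w)) (K.standardBasis d))    ≡⟨ cong (L.lincomb basis) (VP.map-cong ιV-ν (K.standardBasis d)) ⟩
        L.lincomb basis (mapV (λ e → L.lincomb (ιV (ν e)) ιb) (K.standardBasis d))
          ≡⟨ cong (L.lincomb basis) (VP.map-∘ (λ a → L.lincomb a ιb) (λ e → ιV (ν e)) (K.standardBasis d)) ⟩
        L.lincomb basis (mapV (λ a → L.lincomb a ιb) (mapV (λ e → ιV (ν e)) (K.standardBasis d)))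
          ≡⟨ L.lincomb-∘ basis _ ιb ⟩
        L.lincomb (L.lincomb basis (mapV (λ e → ιV (ν e)) (K.standardBasis d))) ιb ∎)
      where
      πw∈V : ∀ e → K.SpanPerp G ps t (π e w)
      πw∈V e = (π e l , trans (sym (π-lincomb e l G)) (cong (π e) el)) ,
               λ p∈ → trans (dot-map e w (t _)) (trans (cong (λ z → K.dot e (coord z)) (w⊥ p∈))
                                                        (trans (cong (K.dot e) φ-0) (K.dot-zeroʳ e)))
      ν : Vec K.C d → Vec K.C dd
      ν e = proj₁ (V⊆b (π e w) (πw∈V e))
      ιV-ν : ∀ e → ιV (π e w) ≡ L.lincomb (ιV (ν e)) ιb
      ιV-ν e = trans (cong ιV (sym (proj₂ (V⊆b (π e w) (πw∈V e))))) (ιV-lincomb (ν e) b)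

    span⊆SpanPerp-ιV : (∀ {v} → v ∈ toList b → K.SpanPerp G ps t v) →
                       ∀ a → L.SpanPerp ιG ps (ιV ∘ t) (L.lincomb a ιb)
    span⊆SpanPerp-ιV b⊆V a = (L.lincomb a (mapV ιV A) , inSpan) , ⊥ps
      where
      A : Vec (Vec K.C k) dd
      A = proj₁ (K.span-coefficients G b (λ v∈ → proj₁ (b⊆V v∈)))
      ιb≡ : ιb ≡ mapV (λ a' → L.lincomb a' ιG) (mapV ιV A)
      ιb≡ = begin
        mapV ιV b                                    ≡⟨ cong (mapV ιV) (sym (proj₂ (K.span-coefficients G b (λ v∈ → proj₁ (b⊆V v∈))))) ⟩
        mapV ιV (mapV (λ a' → K.lincomb a' G) A)     ≡⟨ sym (VP.map-∘ ιV _ A) ⟩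
        mapV (λ a' → ιV (K.lincomb a' G)) A          ≡⟨ VP.map-cong (λ a' → ιV-lincomb a' G) A ⟩
        mapV (λ a' → L.lincomb (ιV a') ιG) A         ≡⟨ VP.map-∘ (λ a' → L.lincomb a' ιG) ιV A ⟩
        mapV (λ a' → L.lincomb a' ιG) (mapV ιV A)    ∎
      inSpan : L.lincomb (L.lincomb a (mapV ιV A)) ιG ≡ L.lincomb a ιb
      inSpan = trans (sym (L.lincomb-∘ a (mapV ιV A) ιG)) (cong (L.lincomb a) (sym ιb≡))
      ⊥ps : ∀ {p} → p ∈ ps → L.dot (L.lincomb a ιb) (ιV (t p)) ≡ 0ₗ
      ⊥ps {p} p∈ = begin
        L.dot (L.lincomb a ιb) (ιV (t p))                  ≡⟨ L.dot-lincombˡ a ιb _ ⟩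
        L.dot a (mapV (λ v → L.dot v (ιV (t p))) ιb)       ≡⟨ cong (L.dot a) (sym (VP.map-∘ _ ιV b)) ⟩
        L.dot a (mapV (λ v → L.dot (ιV v) (ιV (t p))) b)
          ≡⟨ cong (L.dot a) (L.map-zero _ b (λ {v} v∈ → trans (dot-ι v (t p)) (trans (cong ι (proj₂ (b⊆V v∈) p∈)) ι-0))) ⟩
        L.dot a L.zeroV                                    ≡⟨ L.dot-zeroʳ a ⟩
        0ₗ                                                 ∎

    count-SpanPerp-ιV : K.LinIndep b → (∀ {v} → v ∈ toList b → K.SpanPerp G ps t v) →
                        (∀ w → K.SpanPerp G ps t w → ∃ λ a → K.lincomb a b ≡ w) →
                        (P : Vec L.C n → Bool) →
                        (∀ w → P w ≡ true → L.SpanPerp ιG ps (ιV ∘ t) w) →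
                        (∀ w → L.SpanPerp ιG ps (ιV ∘ t) w → P w ≡ true) →
                        length (filterᵇ P (L.allVecs n)) ≡ FiniteField.size L ^ℕ dd
    count-SpanPerp-ιV li b⊆V V⊆b P P⇒V V⇒P =
      L.count-span ιb (ιV-LinIndep b li) P
        (λ w Pw → SpanPerp-ιV⊆span V⊆b w (P⇒V w Pw))
        (λ a → V⇒P _ (span⊆SpanPerp-ιV b⊆V a))

module Tower (J K L : FiniteField) (m r : ℕ) (E₁ : Extension J K m) (E₂ : Extension K L r) where
  module X₁ = FieldExtension J K m E₁
  module X₂ = FieldExtension K L r E₂
  module J' = VectorSpace J
  module K' = VectorSpace K
  ι₁ : J'.C → K'.C
  ι₁ = Extension.ι E₁
  ι₂ : K'.C → FiniteField.Carrier L
  ι₂ = Extension.ι E₂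
  c₁ : K'.C → Vec J'.C m
  c₁ = Extension.coord E₁
  c₂ : FiniteField.Carrier L → Vec K'.C r
  c₂ = Extension.coord E₂

  ι₂₁ : FiniteField.Carrier J → FiniteField.Carrier L
  ι₂₁ a = ι₂ (ι₁ a)

  ι₂₁-+ : ∀ x y → ι₂₁ (FiniteField._+_ J x y) ≡ FiniteField._+_ L (ι₂₁ x) (ι₂₁ y)
  ι₂₁-+ x y = trans (cong ι₂ (Extension.ι-+ E₁ x y)) (Extension.ι-+ E₂ _ _)
  ι₂₁-* : ∀ x y → ι₂₁ (FiniteField._*_ J x y) ≡ FiniteField._*_ L (ι₂₁ x) (ι₂₁ y)
  ι₂₁-* x y = trans (cong ι₂ (Extension.ι-* E₁ x y)) (Extension.ι-* E₂ _ _)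
  ι₂₁-1 : ι₂₁ (FiniteField.1# J) ≡ FiniteField.1# L
  ι₂₁-1 = trans (cong ι₂ (Extension.ι-1 E₁)) (Extension.ι-1 E₂)

  ψ : FiniteField.Carrier L → Vec (FiniteField.Carrier J) (r *ℕ m)
  ψ x = concat (mapV c₁ (c₂ x))

  mapc₁-⊕ : {k : ℕ} (u v : Vec K'.C k) → mapV c₁ (K'._⊕_ u v) ≡ zipWith J'._⊕_ (mapV c₁ u) (mapV c₁ v)
  mapc₁-⊕ [] [] = refl
  mapc₁-⊕ (x ∷ u) (y ∷ v) = cong₂ _∷_ (X₁.coord-+ x y) (mapc₁-⊕ u v)

  concat-zip : {k : ℕ} (U V : Vec (Vec J'.C m) k) → concat (zipWith J'._⊕_ U V) ≡ J'._⊕_ (concat U) (concat V)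
  concat-zip [] [] = refl
  concat-zip (u ∷ U) (v ∷ V) = trans (cong (J'._⊕_ u v ++ᵛ_) (concat-zip U V)) (sym (VP.zipWith-++ _ u (concat U) v (concat V)))

  concat-⊙ : {k : ℕ} (a : J'.C) (U : Vec (Vec J'.C m) k) → concat (mapV (J'._⊙_ a) U) ≡ J'._⊙_ a (concat U)
  concat-⊙ a [] = refl
  concat-⊙ a (u ∷ U) = trans (cong (J'._⊙_ a u ++ᵛ_) (concat-⊙ a U)) (sym (VP.map-++ _ u (concat U)))

  mapc₁-⊙ : {k : ℕ} (a : J'.C) (u : Vec K'.C k) → mapV c₁ (K'._⊙_ (ι₁ a) u) ≡ mapV (J'._⊙_ a) (mapV c₁ u)
  mapc₁-⊙ a [] = refl
  mapc₁-⊙ a (x ∷ u) = cong₂ _∷_ (X₁.coord-ι* a x) (mapc₁-⊙ a u)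

  ψ-+ : ∀ x y → ψ (FiniteField._+_ L x y) ≡ J'._⊕_ (ψ x) (ψ y)
  ψ-+ x y = trans (cong (λ z → concat (mapV c₁ z)) (X₂.coord-+ x y))
                  (trans (cong concat (mapc₁-⊕ (c₂ x) (c₂ y))) (concat-zip (mapV c₁ (c₂ x)) (mapV c₁ (c₂ y))))

  ψ-ι* : ∀ a y → ψ (FiniteField._*_ L (ι₂₁ a) y) ≡ J'._⊙_ a (ψ y)
  ψ-ι* a y = trans (cong (λ z → concat (mapV c₁ z)) (X₂.coord-ι* (ι₁ a) y))
                   (trans (cong concat (mapc₁-⊙ a (c₂ y))) (concat-⊙ a (mapV c₁ (c₂ y))))

  ++-zero : {k₁ k₂ : ℕ} (u : Vec J'.C k₁) (w : Vec J'.C k₂) → u ++ᵛ w ≡ J'.zeroV → (u ≡ J'.zeroV) × (w ≡ J'.zeroV)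
  ++-zero [] w e = refl , e
  ++-zero (x ∷ u) w e = let (a , b) = ++-zero u w (proj₂ (VP.∷-injective e)) in cong₂ _∷_ (proj₁ (VP.∷-injective e)) a , b

  concat-zero : {k : ℕ} (U : Vec K'.C k) → concat (mapV c₁ U) ≡ J'.zeroV → U ≡ K'.zeroV
  concat-zero [] e = refl
  concat-zero (x ∷ U) e = let (a , b) = ++-zero (c₁ x) _ e in cong₂ _∷_ (X₁.coord≡0⇒≡0 x a) (concat-zero U b)

  ψ≡0⇒≡0 : ∀ y → ψ y ≡ J'.zeroV → y ≡ FiniteField.0# L
  ψ≡0⇒≡0 y e = X₂.coord≡0⇒≡0 y (concat-zero _ e)

  module RowSupport₂₁ = RowSupport J L ι₂₁ ι₂₁-+ ι₂₁-* ι₂₁-1 (r *ℕ m) ψ ψ-+ ψ-ι* ψ≡0⇒≡0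

[_]ℤ : Bool → ℤ
[ true ]ℤ = + 1
[ false ]ℤ = + 0

sum-++ : (xs ys : List ℤ) → sumℤ (xs Data.List.++ ys) ≡ sumℤ xs +ℤ sumℤ ys
sum-++ [] ys = sym (IP.+-identityˡ _)
sum-++ (x ∷ xs) ys = trans (cong (x +ℤ_) (sum-++ xs ys)) (sym (IP.+-assoc x _ _))

module _ {A : Set} where
  sum-cong : (f g : A → ℤ) → (∀ x → f x ≡ g x) → (xs : List A) → sumℤ (mapL f xs) ≡ sumℤ (mapL g xs)
  sum-cong f g e xs = cong sumℤ (LP.map-cong e xs)

  sum-zero : (xs : List A) → sumℤ (mapL (λ _ → + 0) xs) ≡ + 0
  sum-zero [] = refl
  sum-zero (x ∷ xs) = trans (IP.+-identityˡ _) (sum-zero xs)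

  sum-+ : (f g : A → ℤ) (xs : List A) → sumℤ (mapL f xs) +ℤ sumℤ (mapL g xs) ≡ sumℤ (mapL (λ x → f x +ℤ g x) xs)
  sum-+ f g [] = refl
  sum-+ f g (x ∷ xs) = trans (lem (f x) (g x) (sumℤ (mapL f xs)) (sumℤ (mapL g xs))) (cong (f x +ℤ g x +ℤ_) (sum-+ f g xs))
    where
    lem : ∀ a b c d → (a +ℤ c) +ℤ (b +ℤ d) ≡ (a +ℤ b) +ℤ (c +ℤ d)
    lem = solve-∀

  sum-* : (c : ℤ) (f : A → ℤ) (xs : List A) → c *ℤ sumℤ (mapL f xs) ≡ sumℤ (mapL (λ x → c *ℤ f x) xs)
  sum-* c f [] = IP.*-zeroʳ c
  sum-* c f (x ∷ xs) = trans (IP.*-distribˡ-+ c (f x) _) (cong (c *ℤ f x +ℤ_) (sum-* c f xs))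

  sum-neg : (f : A → ℤ) (xs : List A) → sumℤ (mapL (λ x → -ℤ f x) xs) ≡ -ℤ sumℤ (mapL f xs)
  sum-neg f [] = refl
  sum-neg f (x ∷ xs) = trans (cong (-ℤ f x +ℤ_) (sum-neg f xs)) (sym (IP.neg-distrib-+ (f x) _))

  length-filterᵇ : (p : A → Bool) (xs : List A) → + length (filterᵇ p xs) ≡ sumℤ (mapL (λ x → [ p x ]ℤ) xs)
  length-filterᵇ p []       = refl
  length-filterᵇ p (x ∷ xs) with p x
  ... | true  = cong (+ 1 +ℤ_) (length-filterᵇ p xs)
  ... | false = trans (length-filterᵇ p xs) (sym (IP.+-identityˡ _))

module _ {A B : Set} where
  sum-swap : (S : List A) (T : List B) (g : A → B → ℤ) →
    sumℤ (mapL (λ a → sumℤ (mapL (g a) T)) S) ≡ sumℤ (mapL (λ b → sumℤ (mapL (λ a → g a b) S)) T)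
  sum-swap [] T g = sym (sum-zero T)
  sum-swap (a ∷ S) T g = trans (cong (sumℤ (mapL (g a) T) +ℤ_) (sum-swap S T g)) (sum-+ (g a) _ T)

sum-subsets : (N : ℕ) (h : Vec Bool (suc N) → ℤ) →
  sumℤ (mapL h (subsets (suc N))) ≡ sumℤ (mapL (λ γ → h (true ∷ γ)) (subsets N)) +ℤ sumℤ (mapL (λ γ → h (false ∷ γ)) (subsets N))
sum-subsets N h = begin
  sumℤ (mapL h (mapL (true ∷_) S Data.List.++ (mapL (false ∷_) S Data.List.++ [])))
    ≡⟨ cong sumℤ (LP.map-++ h (mapL (true ∷_) S) _) ⟩
  sumℤ (mapL h (mapL (true ∷_) S) Data.List.++ mapL h (mapL (false ∷_) S Data.List.++ []))
    ≡⟨ sum-++ (mapL h (mapL (true ∷_) S)) _ ⟩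
  sumℤ (mapL h (mapL (true ∷_) S)) +ℤ sumℤ (mapL h (mapL (false ∷_) S Data.List.++ []))
    ≡⟨ cong₂ _+ℤ_ (cong sumℤ (sym (LP.map-∘ {g = h} {f = true ∷_} S)))
                  (cong (λ l → sumℤ (mapL h l)) (LP.++-identityʳ (mapL (false ∷_) S))) ⟩
  sumℤ (mapL (λ γ → h (true ∷ γ)) S) +ℤ sumℤ (mapL h (mapL (false ∷_) S))
    ≡⟨ cong (sumℤ (mapL (λ γ → h (true ∷ γ)) S) +ℤ_) (cong sumℤ (sym (LP.map-∘ {g = h} {f = false ∷_} S))) ⟩
  sumℤ (mapL (λ γ → h (true ∷ γ)) S) +ℤ sumℤ (mapL (λ γ → h (false ∷ γ)) S) ∎
  where
  open ≡-Reasoning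
  S : List (Vec Bool N)
  S = subsets N

alternatingSum : {N : ℕ} → (Vec Bool N → ℤ) → ℤ
alternatingSum {N} h = sumℤ (mapL (λ γ → (-1ℤ ^ℤ card γ) *ℤ h γ) (subsets N))

alternatingSum-cong : {N : ℕ} {h h′ : Vec Bool N → ℤ} → (∀ γ → h γ ≡ h′ γ) → alternatingSum h ≡ alternatingSum h′
alternatingSum-cong {N} e = sum-cong _ _ (λ γ → cong ((-1ℤ ^ℤ card γ) *ℤ_) (e γ)) (subsets N)

alternatingSum-all : {A : Set} (N : ℕ) (ps : Vec A N) (g : A → Bool) →
  alternatingSum (λ δ → [ all g (select δ ps) ]ℤ) ≡ [ all (not ∘ g) (toList ps) ]ℤ
alternatingSum-all zero    []       g = refl
alternatingSum-all (suc N) (p ∷ ps) g =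
  trans (sum-subsets N (λ δ → (-1ℤ ^ℤ card δ) *ℤ [ all g (select δ (p ∷ ps)) ]ℤ)) (split (g p) refl)
  where
  open ≡-Reasoning
  t : Vec Bool N → ℤ
  t γ = (-1ℤ ^ℤ card γ) *ℤ [ all g (select γ ps) ]ℤ
  S : ℤ
  S = sumℤ (mapL t (subsets N))
  split : (b : Bool) → g p ≡ b →
    sumℤ (mapL (λ γ → (-1ℤ ^ℤ card (true ∷ γ)) *ℤ [ all g (select (true ∷ γ) (p ∷ ps)) ]ℤ) (subsets N)) +ℤ S
    ≡ [ all (not ∘ g) (toList (p ∷ ps)) ]ℤ
  split true eq rewrite eq = begin
    sumℤ (mapL (λ γ → (-1ℤ *ℤ (-1ℤ ^ℤ card γ)) *ℤ [ all g (select γ ps) ]ℤ) (subsets N)) +ℤ S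
      ≡⟨ cong (_+ℤ S) (sum-cong (λ γ → (-1ℤ *ℤ (-1ℤ ^ℤ card γ)) *ℤ [ all g (select γ ps) ]ℤ) (λ γ → -ℤ t γ)
                         (λ γ → trans (IP.*-assoc -1ℤ (-1ℤ ^ℤ card γ) _) (IP.-1*i≡-i (t γ))) (subsets N)) ⟩
    sumℤ (mapL (λ γ → -ℤ t γ) (subsets N)) +ℤ S
      ≡⟨ cong (_+ℤ S) (sum-neg t (subsets N)) ⟩
    -ℤ S +ℤ S
      ≡⟨ IP.+-inverseˡ S ⟩
    + 0 ∎
  split false eq rewrite eq = begin
    sumℤ (mapL (λ γ → (-1ℤ *ℤ (-1ℤ ^ℤ card γ)) *ℤ + 0) (subsets N)) +ℤ S
      ≡⟨ cong (_+ℤ S) (trans (sum-cong (λ γ → (-1ℤ *ℤ (-1ℤ ^ℤ card γ)) *ℤ + 0) (λ _ → + 0)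
                                         (λ γ → IP.*-zeroʳ (-1ℤ *ℤ (-1ℤ ^ℤ card γ))) (subsets N)) (sum-zero (subsets N))) ⟩
    + 0 +ℤ S
      ≡⟨ IP.+-identityˡ S ⟩
    S
      ≡⟨ alternatingSum-all N ps g ⟩
    [ all (not ∘ g) (toList ps) ]ℤ ∎

inclusion-exclusion : {A B : Set} (N : ℕ) (ps : Vec A N) (xs : List B) (P : B → Bool) (f : B → A → Bool) →
  alternatingSum (λ δ → + length (filterᵇ (λ c → P c ∧ all (f c) (select δ ps)) xs))
  ≡ + length (filterᵇ (λ c → P c ∧ all (λ p → not (f c p)) (toList ps)) xs)
inclusion-exclusion {A} {B} N ps xs P f = begin
  alternatingSum (λ δ → + length (filterᵇ (Pδ δ) xs))
    ≡⟨ sum-cong _ (λ δ → sumℤ (mapL (λ c → sg δ *ℤ [ Pδ δ c ]ℤ) xs))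
         (λ δ → trans (cong (sg δ *ℤ_) (length-filterᵇ (Pδ δ) xs)) (sum-* (sg δ) (λ c → [ Pδ δ c ]ℤ) xs)) (subsets N) ⟩
  sumℤ (mapL (λ δ → sumℤ (mapL (λ c → sg δ *ℤ [ Pδ δ c ]ℤ) xs)) (subsets N))
    ≡⟨ sum-swap (subsets N) xs (λ δ c → sg δ *ℤ [ Pδ δ c ]ℤ) ⟩
  sumℤ (mapL (λ c → alternatingSum (λ δ → [ Pδ δ c ]ℤ)) xs)
    ≡⟨ sum-cong _ (λ c → [ P∅ c ]ℤ) per-element xs ⟩
  sumℤ (mapL (λ c → [ P∅ c ]ℤ) xs)
    ≡⟨ sym (length-filterᵇ P∅ xs) ⟩
  + length (filterᵇ P∅ xs) ∎
  where
  open ≡-Reasoning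
  sg : Vec Bool N → ℤ
  sg δ = -1ℤ ^ℤ card δ
  Pδ : Vec Bool N → B → Bool
  Pδ δ c = P c ∧ all (f c) (select δ ps)
  P∅ : B → Bool
  P∅ c = P c ∧ all (λ p → not (f c p)) (toList ps)
  per-element : ∀ c → alternatingSum (λ δ → [ Pδ δ c ]ℤ) ≡ [ P∅ c ]ℤ
  per-element c with P c
  ... | true  = alternatingSum-all N ps (f c)
  ... | false = trans (sum-cong _ (λ _ → + 0) (λ γ → IP.*-zeroʳ (sg γ)) (subsets N)) (sum-zero (subsets N))

-1^N*-1^|γ|≡-1^|∁γ| : (N : ℕ) (γ : Vec Bool N) → (-1ℤ ^ℤ N) *ℤ (-1ℤ ^ℤ card γ) ≡ -1ℤ ^ℤ card (mapV not γ)
-1^N*-1^|γ|≡-1^|∁γ| zero    []          = refl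
-1^N*-1^|γ|≡-1^|∁γ| (suc N) (true ∷ γ)  = trans (neg-neg (-1ℤ ^ℤ N) (-1ℤ ^ℤ card γ)) (-1^N*-1^|γ|≡-1^|∁γ| N γ)
  where
  neg-neg : ∀ a b → (-1ℤ *ℤ a) *ℤ (-1ℤ *ℤ b) ≡ a *ℤ b
  neg-neg = solve-∀
-1^N*-1^|γ|≡-1^|∁γ| (suc N) (false ∷ γ) =
  trans (IP.*-assoc -1ℤ (-1ℤ ^ℤ N) (-1ℤ ^ℤ card γ)) (cong (-1ℤ *ℤ_) (-1^N*-1^|γ|≡-1^|∁γ| N γ))

sum-subsets-∁ : (N : ℕ) (h : Vec Bool N → ℤ) → sumℤ (mapL (h ∘ mapV not) (subsets N)) ≡ sumℤ (mapL h (subsets N))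
sum-subsets-∁ zero    h = refl
sum-subsets-∁ (suc N) h = begin
  sumℤ (mapL (h ∘ mapV not) (subsets (suc N)))
    ≡⟨ sum-subsets N (h ∘ mapV not) ⟩
  sumℤ (mapL (λ γ → h (false ∷ mapV not γ)) (subsets N)) +ℤ sumℤ (mapL (λ γ → h (true ∷ mapV not γ)) (subsets N))
    ≡⟨ cong₂ _+ℤ_ (sum-subsets-∁ N (λ γ → h (false ∷ γ))) (sum-subsets-∁ N (λ γ → h (true ∷ γ))) ⟩
  sumℤ (mapL (λ γ → h (false ∷ γ)) (subsets N)) +ℤ sumℤ (mapL (λ γ → h (true ∷ γ)) (subsets N))
    ≡⟨ IP.+-comm (sumℤ (mapL (λ γ → h (false ∷ γ)) (subsets N))) _ ⟩
  sumℤ (mapL (λ γ → h (true ∷ γ)) (subsets N)) +ℤ sumℤ (mapL (λ γ → h (false ∷ γ)) (subsets N))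
    ≡⟨ sym (sum-subsets N h) ⟩
  sumℤ (mapL h (subsets (suc N))) ∎
  where open ≡-Reasoning

alternatingSum-∁ : (N : ℕ) (h : Vec Bool N → ℤ) → (-1ℤ ^ℤ N) *ℤ alternatingSum (h ∘ mapV not) ≡ alternatingSum h
alternatingSum-∁ N h = begin
  (-1ℤ ^ℤ N) *ℤ alternatingSum (h ∘ mapV not)
    ≡⟨ sum-* (-1ℤ ^ℤ N) _ (subsets N) ⟩
  sumℤ (mapL (λ γ → (-1ℤ ^ℤ N) *ℤ ((-1ℤ ^ℤ card γ) *ℤ h (mapV not γ))) (subsets N))
    ≡⟨ sum-cong _ _ (λ γ → trans (sym (IP.*-assoc (-1ℤ ^ℤ N) (-1ℤ ^ℤ card γ) _))
                                 (cong (_*ℤ h (mapV not γ)) (-1^N*-1^|γ|≡-1^|∁γ| N γ))) (subsets N) ⟩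
  sumℤ (mapL (λ γ → (-1ℤ ^ℤ card (mapV not γ)) *ℤ h (mapV not γ)) (subsets N))
    ≡⟨ sum-subsets-∁ N (λ δ → (-1ℤ ^ℤ card δ) *ℤ h δ) ⟩
  alternatingSum h ∎
  where open ≡-Reasoning

select-length : {A : Set} {N : ℕ} (γ : Vec Bool N) (v : Vec A N) → length (select γ v) ≡ card γ
select-length [] [] = refl
select-length (true ∷ γ) (x ∷ v) = cong suc (select-length γ v)
select-length (false ∷ γ) (x ∷ v) = select-length γ v

select-⊎-select∁ : {A : Set} {N : ℕ} (γ : Vec Bool N) (v : Vec A N) {x : A} → x ∈ toList v → (x ∈ select γ v) ⊎ (x ∈ select (mapV not γ) v)
select-⊎-select∁ (true ∷ γ) (y ∷ v) (here refl) = inj₁ (here refl)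
select-⊎-select∁ (false ∷ γ) (y ∷ v) (here refl) = inj₂ (here refl)
select-⊎-select∁ (true ∷ γ) (y ∷ v) (there x∈) with select-⊎-select∁ γ v x∈
... | inj₁ a = inj₁ (there a)
... | inj₂ b = inj₂ b
select-⊎-select∁ (false ∷ γ) (y ∷ v) (there x∈) with select-⊎-select∁ γ v x∈
... | inj₁ a = inj₁ a
... | inj₂ b = inj₂ (there b)

card-replicate-false : (N : ℕ) → card (replicate N false) ≡ 0
card-replicate-false zero = refl
card-replicate-false (suc N) = card-replicate-false N

-- n*(γ) = |γ| ∸ (|γ| + ρ(∁γ) ∸ ρ(P(E))) with ρ(∁γ) = k ∸ D and ρ(P(E)) = k ∸ 0; the bounds make every
-- truncated subtraction exact.
dual-nullity-arith : (c k D : ℕ) → D ≤ k → D ≤ c → c ∸ ((c +ℕ (k ∸ D)) ∸ (k ∸ 0)) ≡ D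
dual-nullity-arith c k D D≤k D≤c = trans (cong (c ∸_) e) (NP.m∸[m∸n]≡n D≤c)
  where
  open ≡-Reasoning
  e : (c +ℕ (k ∸ D)) ∸ (k ∸ 0) ≡ c ∸ D
  e = begin
    (c +ℕ (k ∸ D)) ∸ k ≡⟨ cong (λ z → (z +ℕ (k ∸ D)) ∸ k) (sym (NP.m∸n+n≡m D≤c)) ⟩
    (((c ∸ D) +ℕ D) +ℕ (k ∸ D)) ∸ k ≡⟨ cong (_∸ k) (NP.+-assoc (c ∸ D) D (k ∸ D)) ⟩
    ((c ∸ D) +ℕ (D +ℕ (k ∸ D))) ∸ k ≡⟨ cong (λ z → ((c ∸ D) +ℕ z) ∸ k) (NP.m+[n∸m]≡n D≤k) ⟩
    ((c ∸ D) +ℕ k) ∸ k ≡⟨ NP.m+n∸n≡m (c ∸ D) k ⟩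
    c ∸ D ∎

module Count (Fq FQ FQt : FiniteField) (m r n k : ℕ)
             (E₁ : Extension Fq FQ m) (E₂ : Extension FQ FQt r)
             (G : Vec (Vec (FiniteField.Carrier FQ) n) k) where
  open Gabidulin Fq FQ FQt m r n k E₁ E₂ G
  private
    module q  = VectorSpace Fq
    module Q  = VectorSpace FQ
    module Qt = VectorSpace FQt
    module Ext₁ = FieldExtension Fq FQ m E₁
    module Ext₂ = FieldExtension FQ FQt r E₂
    module Tw = Tower Fq FQ FQt m r E₁ E₂
    module Ext₂₁ = Tw.RowSupport₂₁
  open ≡-Reasoning

  PE-∈⁺ : {p : Vec q.C n} → p ∈ q.points n → p ∈ toList PE
  PE-∈⁺ = subst (_ ∈_) (sym (VP.toList∘fromList (q.points n)))

  PE-∈⁻ : {p : Vec q.C n} → p ∈ toList PE → p ∈ q.points n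
  PE-∈⁻ = subst (_ ∈_) (VP.toList∘fromList (q.points n))

  annihilates : Vec Qt.C n → Vec q.C n → Bool
  annihilates c p = Qt.isZero (Qt.dot c (Ext₂₁.ιV p))

  rankWeight≡n⇒¬annihilates : ∀ c → rankWeight c ≡ n → ∀ {p} → p ∈ toList PE → annihilates c p ≡ false
  rankWeight≡n⇒¬annihilates c rw {p} p∈ with annihilates c p in eq
  ... | false = refl
  ... | true  = ⊥-elim (q.points-≢0 (PE-∈⁻ p∈)
                  (q.fullDim⇒perp≡0 (transpose (mapV coordt c)) rw p (Ext₂₁.dot≡0⇒Rsupp-⊥ c p (Qt.isZero-true eq))))

  ¬annihilates⇒rankWeight≡n : ∀ c → (∀ {p} → p ∈ toList PE → annihilates c p ≡ false) → rankWeight c ≡ n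
  ¬annihilates⇒rankWeight≡n c ¬ann = q.perp≡0⇒fullDim (transpose (mapV coordt c)) ⊥Rsupp⇒0
    where
    ⊥Rsupp⇒0 : ∀ x → (∀ w → Ext₂₁.Rsupp c w ≡ true → q.dot w x ≡ FiniteField.0# Fq) → x ≡ q.zeroV
    ⊥Rsupp⇒0 x x⊥ with x q.≟V q.zeroV
    ... | yes x≡0 = x≡0
    ... | no  x≢0 =
      let (a , a≢0 , p , p∈ , x≡ap) = q.point-multiple x x≢0
          c·ιx≡0 : Qt.dot c (Ext₂₁.ιV x) ≡ FiniteField.0# FQt
          c·ιx≡0 = Ext₂₁.Rsupp-⊥⇒dot≡0 c x x⊥
          ιa*c·ιp≡0 : Tw.ι₂₁ a Qt.* Qt.dot c (Ext₂₁.ιV p) ≡ FiniteField.0# FQt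
          ιa*c·ιp≡0 = begin
            Tw.ι₂₁ a Qt.* Qt.dot c (Ext₂₁.ιV p)  ≡⟨ sym (Qt.dot-⊙ʳ (Tw.ι₂₁ a) c (Ext₂₁.ιV p)) ⟩
            Qt.dot c (Tw.ι₂₁ a Qt.⊙ Ext₂₁.ιV p) ≡⟨ cong (Qt.dot c) (sym (Ext₂₁.ιV-⊙ a p)) ⟩
            Qt.dot c (Ext₂₁.ιV (a q.⊙ p))        ≡⟨ cong (λ z → Qt.dot c (Ext₂₁.ιV z)) (sym x≡ap) ⟩
            Qt.dot c (Ext₂₁.ιV x)                ≡⟨ c·ιx≡0 ⟩
            FiniteField.0# FQt                  ∎
      in ⊥-elim (Qt.isZero-false (¬ann (PE-∈⁺ p∈)) (Qt.x*y≡0⇒y≡0 (Ext₂₁.ι-≢0 a≢0) ιa*c·ιp≡0))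

  fullRank≡noneAnnihilated : ∀ c → ⌊ rankWeight c ≟ℕ n ⌋ ≡ all (λ p → not (annihilates c p)) (toList PE)
  fullRank≡noneAnnihilated c = bool-ext
    (λ h → all⁺ _ (toList PE) λ p∈ → cong not (rankWeight≡n⇒¬annihilates c (⌊≟⌋-true⇒≡ _≟ℕ_ h) p∈))
    (λ h → ≡⇒⌊≟⌋-true _≟ℕ_ (¬annihilates⇒rankWeight≡n c λ p∈ → not-true⇒false (all⁻ _ h p∈)))

  A≡#noneAnnihilated : A ≡ length (filterᵇ (λ c → inC̃ c ∧ all (not ∘ annihilates c) (toList PE)) (Qt.allVecs n))
  A≡#noneAnnihilated = cong length (filterᵇ-cong _ _ (λ c → cong (inC̃ c ∧_) (fullRank≡noneAnnihilated c)) (Qt.allVecs n))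

  subcode : List (Vec q.C n) → Vec Q.C n → Bool
  subcode ps = C[ q.perp (q.inSpan (fromList ps)) ]

  subcode⇒SpanPerp : (ps : List (Vec q.C n)) (c : Vec Q.C n) → subcode ps c ≡ true → Q.SpanPerp G ps Ext₁.ιV c
  subcode⇒SpanPerp ps c h =
    let (c∈C , Rsupp⊆) = ∧-elim h
        ⊥span : ∀ a → Q.dot c (Ext₁.ιV (q.lincomb a (fromList ps))) ≡ FiniteField.0# FQ
        ⊥span a = Ext₁.Rsupp-⊥⇒dot≡0 c _ λ w w∈ →
          q.perp⁻ (q.inSpan (fromList ps)) {w} (q.⊆⁻ (Ext₁.Rsupp c) (q.perp (q.inSpan (fromList ps))) Rsupp⊆ w w∈) _ (q.inSpan⁺ (fromList ps) a)
    in Q.inSpan⁻ G c∈C , λ {p} p∈ → Ext₁.dot-lincomb≡0⇒dot≡0 c (fromList ps) ⊥span (subst (p ∈_) (sym (VP.toList∘fromList ps)) p∈)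

  SpanPerp⇒subcode : (ps : List (Vec q.C n)) (c : Vec Q.C n) → Q.SpanPerp G ps Ext₁.ιV c → subcode ps c ≡ true
  SpanPerp⇒subcode ps c ((a , ea) , c⊥) = ∧-intro (subst (λ u → Q.inSpan G u ≡ true) ea (Q.inSpan⁺ G a))
    (q.⊆⁺ (Ext₁.Rsupp c) _ λ w w∈ → q.perp⁺ (q.inSpan (fromList ps)) w λ x x∈ →
      let (b , eb) = q.inSpan⁻ (fromList ps) x∈
          c⊥x : Q.dot c (Ext₁.ιV x) ≡ FiniteField.0# FQ
          c⊥x = subst (λ u → Q.dot c (Ext₁.ιV u) ≡ _) eb
                  (Ext₁.dot≡0⇒dot-lincomb≡0 c (fromList ps) (λ {p} p∈ → c⊥ (subst (p ∈_) (VP.toList∘fromList ps) p∈)) b)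
      in Ext₁.dot≡0⇒Rsupp-⊥ c x c⊥x w w∈)

  extendedSubcode : List (Vec q.C n) → Vec Qt.C n → Bool
  extendedSubcode ps c = inC̃ c ∧ all (annihilates c) ps

  private
    ιV₂₁≡ : (p : Vec q.C n) → Ext₂₁.ιV p ≡ Ext₂.ιV (Ext₁.ιV p)
    ιV₂₁≡ = VP.map-∘ (Extension.ι E₂) (Extension.ι E₁)

  extendedSubcode⇒SpanPerp : (ps : List (Vec q.C n)) (c : Vec Qt.C n) → extendedSubcode ps c ≡ true →
                             Qt.SpanPerp (mapV Ext₂.ιV G) ps (Ext₂.ιV ∘ Ext₁.ιV) c
  extendedSubcode⇒SpanPerp ps c h = let (c∈C̃ , ann) = ∧-elim h in
    Qt.inSpan⁻ _ c∈C̃ , λ {p} p∈ → trans (cong (Qt.dot c) (sym (ιV₂₁≡ p))) (Qt.isZero-true (all⁻ (annihilates c) ann p∈))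

  SpanPerp⇒extendedSubcode : (ps : List (Vec q.C n)) (c : Vec Qt.C n) →
                             Qt.SpanPerp (mapV Ext₂.ιV G) ps (Ext₂.ιV ∘ Ext₁.ιV) c → extendedSubcode ps c ≡ true
  SpanPerp⇒extendedSubcode ps c ((a , ea) , c⊥) =
    ∧-intro (subst (λ u → Qt.inSpan (mapV Ext₂.ιV G) u ≡ true) ea (Qt.inSpan⁺ _ a))
            (all⁺ (annihilates c) ps λ {p} p∈ → Qt.isZero-≡ (trans (cong (Qt.dot c) (ιV₂₁≡ p)) (c⊥ p∈)))

  subcodeDim : Vec Bool N → ℕ
  subcodeDim δ = Q.dim (subcode (select δ PE))

  #extendedSubcode : (δ : Vec Bool N) → length (filterᵇ (extendedSubcode (select δ PE)) (Qt.allVecs n)) ≡ Q̃ ^ℕ subcodeDim δ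
  #extendedSubcode δ =
    let ps = select δ PE
        (b , li , b∈) = Q.dim-basis (subcode ps)
    in trans (Ext₂.count-SpanPerp-ιV G ps Ext₁.ιV b li
                (λ v∈ → subcode⇒SpanPerp ps _ (all⁻ (subcode ps) b∈ v∈))
                (λ w w∈V → Q.dim-basis-spans (subcode ps) b li b∈ w (SpanPerp⇒subcode ps w w∈V))
                (extendedSubcode ps) (extendedSubcode⇒SpanPerp ps) (SpanPerp⇒extendedSubcode ps))
             (cong (_^ℕ subcodeDim δ) Ext₂.size-ext)

  subcodeDim≤k : (δ : Vec Bool N) → subcodeDim δ ≤ k
  subcodeDim≤k δ =
    let (b , li , b∈) = Q.dim-basis (subcode (select δ PE))
    in Q.LinIndep-⊆span⇒≤ G b li (λ v∈ → proj₁ (subcode⇒SpanPerp (select δ PE) _ (all⁻ (subcode (select δ PE)) b∈ v∈)))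

  subcodeDim[∁γ]≤|γ| : (γ : Vec Bool N) → subcodeDim (mapV not γ) ≤ card γ
  subcodeDim[∁γ]≤|γ| γ =
    let (b , li , b∈) = Q.dim-basis (subcode (select (mapV not γ) PE))
        ⊥∁γ : ∀ {v} → v ∈ toList b → ∀ {p} → p ∈ select (mapV not γ) PE → Q.dot v (Ext₁.ιV p) ≡ FiniteField.0# FQ
        ⊥∁γ v∈ = proj₂ (subcode⇒SpanPerp _ _ (all⁻ _ b∈ v∈))
        ⊥γ⇒0 : ∀ a → (∀ {p} → p ∈ select γ PE → Q.dot (Q.lincomb a b) (Ext₁.ιV p) ≡ FiniteField.0# FQ) →
               Q.lincomb a b ≡ Q.zeroV
        ⊥γ⇒0 a ⊥γ = Ext₁.points-nondeg _ λ p∈ →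
          [ ⊥γ , (λ p∈∁γ → Q.lincomb-⊥ b (Ext₁.ιV _) (λ v∈ → ⊥∁γ v∈ p∈∁γ) a) ]′ (select-⊎-select∁ γ PE (PE-∈⁺ p∈))
    in subst (subcodeDim (mapV not γ) ≤_) (select-length γ PE) (Q.LinIndep-⊥-injective⇒≤ b (select γ PE) Ext₁.ιV li ⊥γ⇒0)

  subcodeDim-all≡0 : subcodeDim (replicate N true) ≡ 0
  subcodeDim-all≡0 = NP.n≤0⇒n≡0 (subst₂ (λ δ c → subcodeDim δ ≤ c) (VP.map-replicate not false N) (card-replicate-false N)
                                           (subcodeDim[∁γ]≤|γ| (replicate N false)))

  n*≡subcodeDim[∁γ] : (γ : Vec Bool N) → n* γ ≡ subcodeDim (mapV not γ)
  n*≡subcodeDim[∁γ] γ =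
    trans (cong (λ z → card γ ∸ ((card γ +ℕ (k ∸ subcodeDim (mapV not γ))) ∸ (k ∸ z))) subcodeDim-all≡0)
          (dual-nullity-arith (card γ) k (subcodeDim (mapV not γ)) (subcodeDim≤k (mapV not γ)) (subcodeDim[∁γ]≤|γ| γ))

proposition4p7 : (Fq FQ FQt : FiniteField) (m r n k : ℕ)
                 (E₁ : Extension Fq FQ m) (E₂ : Extension FQ FQt r)
                 (G : Vec (Vec (FiniteField.Carrier FQ) n) k) →
                 LA.LinIndep FQ G →
                 1 ≤ r →
                 + Gabidulin.A Fq FQ FQt m r n k E₁ E₂ G ≡ Gabidulin.RHS Fq FQ FQt m r n k E₁ E₂ G
proposition4p7 Fq FQ FQt m r n k E₁ E₂ G _ _ = begin
  + A
    ≡⟨ cong +_ A≡#noneAnnihilated ⟩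
  + length (filterᵇ (λ c → inC̃ c ∧ all (not ∘ annihilates c) (toList PE)) FQ̃ⁿ)
    ≡⟨ sym (inclusion-exclusion N PE FQ̃ⁿ inC̃ annihilates) ⟩
  alternatingSum (λ δ → + length (filterᵇ (extendedSubcode (select δ PE)) FQ̃ⁿ))
    ≡⟨ alternatingSum-cong (λ δ → cong +_ (#extendedSubcode δ)) ⟩
  alternatingSum (λ δ → + (Q̃ ^ℕ subcodeDim δ))
    ≡⟨ sym (alternatingSum-∁ N (λ δ → + (Q̃ ^ℕ subcodeDim δ))) ⟩
  (-1ℤ ^ℤ N) *ℤ alternatingSum (λ γ → + (Q̃ ^ℕ subcodeDim (mapV not γ)))
    ≡⟨ cong ((-1ℤ ^ℤ N) *ℤ_) (alternatingSum-cong (λ γ → cong (λ d → + (Q̃ ^ℕ d)) (sym (n*≡subcodeDim[∁γ] γ)))) ⟩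
  RHS ∎
  where
  open ≡-Reasoning
  open Gabidulin Fq FQ FQt m r n k E₁ E₂ G
  open Count Fq FQ FQt m r n k E₁ E₂ G
  FQ̃ⁿ : List (Vec (FiniteField.Carrier FQt) n)
  FQ̃ⁿ = VectorSpace.allVecs FQt n
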